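{- Let $d\ge1$, $k\ge1$, and let $\Gamma$ be a subtree of $T_k$ of type $\{(\Gamma_1,\alpha_1),\dots,(\Gamma_i,\alpha_i)\}$ whose root vertex has degree $l\le d$ in $\Gamma$. Then (1) $|\mathrm{Aut}\,\Gamma|=\prod_{j=1}^{i}\alpha_j!\,|\mathrm{Aut}\,\Gamma_j|^{\alpha_j}$; (2) $|St_{T_k}(\Gamma)|=(d-l)!\,|\mathrm{Aut}\,T_{k-1}|^{d-l}\prod_{j=1}^{i}\alpha_j!\,|St_{T_{k-1}}(\Gamma_j)|^{\alpha_j}$; (3) $|Fix_{T_k}(\Gamma)|=(d-l)!\,|\mathrm{Aut}\,T_{k-1}|^{d-l}\prod_{j=1}^{i}|Fix_{T_{k-1}}(\Gamma_j)|^{\alpha_j}$.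
   Context: $T_m$ is the rooted $m$-level $d$-regular tree (root at level 0, every vertex at level $<m$ has exactly $d$ children; $T_0$ is a single vertex). A subtree of $T_k$ means a connected subgraph containing the root. $\mathrm{Aut}\,\Gamma$ is the group of automorphisms of $\Gamma$ as a rooted tree (fixing the root). For a subtree $\Gamma$ of $T_m$, $St_{T_m}(\Gamma)$ is the setwise stabilizer of $\Gamma$ in $\mathrm{Aut}\,T_m$ and $Fix_{T_m}(\Gamma)$ is the pointwise stabilizer (fixator) of $\Gamma$ in $\mathrm{Aut}\,T_m$. Each first-level vertex $v$ of $\Gamma$ is the root of the subtree of $\Gamma$ consisting of $v$ and its descendants in $\Gamma$, viewed as a subtree of the copy of $T_{k-1}$ rooted at $v$. Let $\Gamma_1,\dots,\Gamma_i$ be the pairwise non-isomorphic such subtrees and $\alpha_j$ the number of first-level vertices of $\Gamma$ whose subtree is isomorphic to $\Gamma_j$; the type of $\Gamma$ is $\{(\Gamma_1,\alpha_1),\dots,(\Gamma_i,\alpha_i)\}$, and $\sum_j\alpha_j=l$. -}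

module Defs where

open import Level using (_⊔_)
open import Data.Nat using (ℕ; zero; suc; _*_; _^_; _!)
open import Data.Fin using (Fin; zero; suc)
open import Data.Bool using (Bool; true; false; T)
open import Data.Product using (Σ; _×_; _,_; proj₁; proj₂)
open import Data.Sum using (_⊎_)
open import Relation.Binary.PropositionalEquality using (_≡_)

record Card {a ℓ} (A : Set a) (_≈_ : A → A → Set ℓ) (n : ℕ) : Set (a ⊔ ℓ) where
  field
    enum : Fin n → A
    inj  : ∀ i j → enum i ≈ enum j → i ≡ j
    surj : ∀ x → Σ (Fin n) (λ i → enum i ≈ x)

prodFin : ∀ {n} → (Fin n → ℕ) → ℕ
prodFin {zero}  f = 1
prodFin {suc n} f = f zero * prodFin (λ j → f (suc j))

record RootedGraph : Set₁ where
  field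
    V    : Set
    rt   : V
    Adj  : V → V → Set

open RootedGraph

record Iso (G H : RootedGraph) : Set where
  field
    to        : V G → V H
    from      : V H → V G
    from-to   : ∀ x → from (to x) ≡ x
    to-from   : ∀ y → to (from y) ≡ y
    root-pres : to (rt G) ≡ rt H
    adj-pres  : ∀ x y → Adj G x y → Adj H (to x) (to y)
    adj-refl  : ∀ x y → Adj H (to x) (to y) → Adj G x y

open Iso public

Aut : RootedGraph → Set
Aut G = Iso G G

_≈Aut_ : ∀ {G} → Aut G → Aut G → Set
f ≈Aut g = ∀ x → to f x ≡ to g x

-- a vertex of T_m is a path from the root of length ≤ m
data Vtx (d : ℕ) : ℕ → Set where
  root  : ∀ {m} → Vtx d m
  child : ∀ {m} → Fin d → Vtx d m → Vtx d (suc m)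

data Parent {d : ℕ} : ∀ {m} → Vtx d m → Vtx d m → Set where
  here  : ∀ {m} (c : Fin d) → Parent {m = suc m} root (child c root)
  there : ∀ {m} (c : Fin d) {u v : Vtx d m} → Parent u v → Parent (child c u) (child c v)

TAdj : ∀ {d m} → Vtx d m → Vtx d m → Set
TAdj u v = Parent u v ⊎ Parent v u

TreeG : ℕ → ℕ → RootedGraph
TreeG d m = record { V = Vtx d m ; rt = root ; Adj = TAdj }

-- Subtrees of T_m (connected subgraphs containing the root), given by
-- their vertex set (a connected subgraph of a tree is induced)

record Subtree (d m : ℕ) : Set where
  field
    mem    : Vtx d m → Bool
    root∈  : T (mem root)
    closed : ∀ {u v} → Parent u v → T (mem v) → T (mem u)

open Subtree public

SubG : ∀ {d m} → Subtree d m → RootedGraph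
SubG {d} {m} Γ = record
  { V    = Σ (Vtx d m) (λ v → T (mem Γ v))
  ; rt   = root , root∈ Γ
  ; Adj  = λ x y → TAdj (proj₁ x) (proj₁ y)
  }

St : ∀ {d m} → Subtree d m → Set
St {d} {m} Γ = Σ (Aut (TreeG d m))
  (λ g → ∀ v → (T (mem Γ v) → T (mem Γ (to g v))) × (T (mem Γ (to g v)) → T (mem Γ v)))

Fix : ∀ {d m} → Subtree d m → Set
Fix {d} {m} Γ = Σ (Aut (TreeG d m)) (λ g → ∀ v → T (mem Γ v) → to g v ≡ v)

CardAut : RootedGraph → ℕ → Set
CardAut G n = Card (Aut G) _≈Aut_ n

CardSt : ∀ {d m} → Subtree d m → ℕ → Set
CardSt Γ n = Card (St Γ) (λ g h → proj₁ g ≈Aut proj₁ h) n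

CardFix : ∀ {d m} → Subtree d m → ℕ → Set
CardFix Γ n = Card (Fix Γ) (λ g h → proj₁ g ≈Aut proj₁ h) n

FirstLevel : ∀ {d m} → Subtree d (suc m) → Set
FirstLevel {d} Γ = Σ (Fin d) (λ c → T (mem Γ (child c root)))

branch : ∀ {d m} (Γ : Subtree d (suc m)) → FirstLevel Γ → Subtree d m
branch Γ (c , h) = record
  { mem    = λ v → mem Γ (child c v)
  ; root∈  = h
  ; closed = λ p → closed Γ (there c p)
  }

RootDeg : ∀ {d m} → Subtree d (suc m) → ℕ → Set
RootDeg Γ l = Card (FirstLevel Γ) (λ x y → proj₁ x ≡ proj₁ y) l

record IsTypeOf {d m i : ℕ} (Γ : Subtree d (suc m))
                (Γs : Fin i → Subtree d m) (α : Fin i → ℕ) : Set where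
  field
    pairwise-noniso : ∀ j j' → Iso (SubG (Γs j)) (SubG (Γs j')) → j ≡ j'
    covers          : ∀ (x : FirstLevel Γ) → Σ (Fin i) (λ j → Iso (SubG (branch Γ x)) (SubG (Γs j)))
    occurs          : ∀ j → Σ (FirstLevel Γ) (λ x → Iso (SubG (branch Γ x)) (SubG (Γs j)))
    multiplicity    : ∀ j → Card (Σ (FirstLevel Γ) (λ x → Iso (SubG (branch Γ x)) (SubG (Γs j))))
                                 (λ x y → proj₁ (proj₁ x) ≡ proj₁ (proj₁ y)) (α j)

-- An automorphism of a rooted tree permutes the first-level vertices and maps the branch
-- below each of them isomorphically onto the branch below its image; conversely, such a
-- permutation together with branch isomorphisms glues to an automorphism. The data are
-- therefore counted like permutations that respect a partition into classes: a class of
-- size α contributes α! orderings and, for each of its α positions, the number of admissible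
-- branch maps. For Aut Γ the classes are the isomorphism types of branches; for the
-- stabilizer and the fixator in Aut T_k the vertices outside Γ form one more class whose
-- branches are arbitrary, and for the fixator every vertex of Γ is a class of its own. The
-- number of admissible branch maps is transported from Γ_j by conjugating with an
-- automorphism of T_(k-1) that extends an isomorphism between Γ_j and the branch.

module Submission where

open import Defs
open import Data.Nat using (ℕ; zero; suc; _+_; _*_; _^_; _∸_; _!; _≤_)
open import Data.Nat.Properties
  using (≤-antisym; +-identityʳ; *-identityʳ; *-assoc; +-cancelˡ-≡; +-cancelʳ-≡; +-suc; m+n∸n≡m; ^-zeroˡ;
         +-0-commutativeMonoid; *-1-commutativeMonoid; +-*-semiring)
open import Data.Nat.Tactic.RingSolver using (solve-∀)
open import Data.Fin using (Fin; zero; suc; splitAt; join; _↑ˡ_; _↑ʳ_; combine; remQuot; punchIn)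
open import Data.Fin.Properties
  using (splitAt-↑ˡ; splitAt-↑ʳ; join-splitAt; remQuot-combine; combine-remQuot; injective⇒≤;
         0≢1+n; punchIn-injective; punchInᵢ≢i)
  renaming (_≟_ to _≟ᶠ_; suc-injective to Fin-suc-injective)
open import Data.Fin.Permutation
  using (Permutation′; permutation; _⟨$⟩ʳ_; _⟨$⟩ˡ_; insert; remove; punchIn-permute; inverseˡ; inverseʳ)
  renaming (id to idₚ)
open import Data.Bool using (Bool; true; false; T; T?; if_then_else_)
open import Data.Bool.Properties using (T-irrelevant; T-≡) renaming (_≟_ to _≟ᵇ_)
open import Data.Product using (Σ; _×_; _,_; proj₁; proj₂)
open import Data.Product.Relation.Binary.Pointwise.NonDependent using () renaming (Pointwise to ×-Pointwise)
open import Data.Sum using (_⊎_; inj₁; inj₂)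
open import Data.Sum.Relation.Binary.Pointwise using () renaming (Pointwise to ⊎-Pointwise)
import Data.Sum.Relation.Binary.Pointwise as ⊎P
open import Data.Empty using (⊥; ⊥-elim)
open import Data.Unit using (⊤; tt)
open import Relation.Nullary using (Dec; yes; no; does; ¬_)
open import Relation.Binary.Definitions using (DecidableEquality)
open import Relation.Binary.PropositionalEquality
open import Function using (_∘_)
open import Function.Bundles using (_↔_; Inverse; Injection; Equivalence; mk↔ₛ′)
open import Function.Properties.Inverse using (↔-sym; ↔-trans; ↔⇒↣)
open import Algebra.Properties.CommutativeMonoid.Sum +-0-commutativeMonoid using (sum; sum-remove)
open import Algebra.Properties.Semiring.Sum +-*-semiring using (*-distribʳ-sum)
open import Algebra.Properties.CommutativeMonoid.Sum *-1-commutativeMonoid as Product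
  using () renaming (sum to product)

module ↔ = Inverse

open Card

Card-bijection : ∀ {A B : Set} {_≈ᴬ_ : A → A → Set} {_≈ᴮ_ : B → B → Set} {n} →
  Card A _≈ᴬ_ n → (f : A → B) (g : B → A) →
  (∀ {x y} → x ≈ᴬ y → f x ≈ᴮ f y) → (∀ {x y} → f x ≈ᴮ f y → x ≈ᴬ y) →
  (∀ {a b} → a ≈ᴬ g b → f a ≈ᴮ b) → Card B _≈ᴮ_ n
Card-bijection C f g f-cong f-reflects g-inverse = record
  { enum = λ i → f (enum C i)
  ; inj  = λ i j e → inj C i j (f-reflects e)
  ; surj = λ b → proj₁ (surj C (g b)) , g-inverse (proj₂ (surj C (g b)))
  }

Card-unique : ∀ {A : Set} {_≈_ : A → A → Set} {n m} →
  (∀ {x y} → x ≈ y → y ≈ x) → (∀ {x y z} → x ≈ y → y ≈ z → x ≈ z) →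
  Card A _≈_ n → Card A _≈_ m → n ≡ m
Card-unique {A} {_≈_} sym≈ trans≈ C D = ≤-antisym (Card-≤ C D) (Card-≤ D C)
  where
  Card-≤ : ∀ {n m} → Card A _≈_ n → Card A _≈_ m → n ≤ m
  Card-≤ C D = injective⇒≤ {f = λ i → proj₁ (surj D (enum C i))} λ {i} {j} e →
    inj C i j (trans≈ (sym≈ (proj₂ (surj D (enum C i))))
                      (subst (λ k → enum D k ≈ enum C j) (sym e) (proj₂ (surj D (enum C j)))))

Card-empty : ∀ {A : Set} {_≈_ : A → A → Set} → ¬ A → Card A _≈_ 0
Card-empty ¬a = record { enum = λ () ; inj = λ () ; surj = λ x → ⊥-elim (¬a x) }

Card-singleton : ∀ {A : Set} {_≈_ : A → A → Set} (a : A) → (∀ x → a ≈ x) → Card A _≈_ 1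
Card-singleton a a≈ = record { enum = λ _ → a ; inj = λ { zero zero _ → refl } ; surj = λ x → zero , a≈ x }

Card-⊎ : ∀ {A B : Set} {_≈ᴬ_ : A → A → Set} {_≈ᴮ_ : B → B → Set} {n m} →
  Card A _≈ᴬ_ n → Card B _≈ᴮ_ m → Card (A ⊎ B) (⊎-Pointwise _≈ᴬ_ _≈ᴮ_) (n + m)
Card-⊎ {A} {B} {_≈ᴬ_} {_≈ᴮ_} {n} {m} C D = record { enum = enum⊎ ; inj = inj⊎ ; surj = surj⊎ }
  where
  enumSplit : Fin n ⊎ Fin m → A ⊎ B
  enumSplit (inj₁ i) = inj₁ (enum C i)
  enumSplit (inj₂ j) = inj₂ (enum D j)
  enum⊎ : Fin (n + m) → A ⊎ B
  enum⊎ k = enumSplit (splitAt n k)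
  injSplit : ∀ s s' → ⊎-Pointwise _≈ᴬ_ _≈ᴮ_ (enumSplit s) (enumSplit s') → s ≡ s'
  injSplit (inj₁ i) (inj₁ i') (⊎P.inj₁ e) = cong inj₁ (inj C i i' e)
  injSplit (inj₂ j) (inj₂ j') (⊎P.inj₂ e) = cong inj₂ (inj D j j' e)
  inj⊎ : ∀ k k' → ⊎-Pointwise _≈ᴬ_ _≈ᴮ_ (enum⊎ k) (enum⊎ k') → k ≡ k'
  inj⊎ k k' e = begin
    k                         ≡⟨ join-splitAt n m k ⟨
    join n m (splitAt n k)    ≡⟨ cong (join n m) (injSplit _ _ e) ⟩
    join n m (splitAt n k')   ≡⟨ join-splitAt n m k' ⟩
    k'                        ∎
    where open ≡-Reasoning
  surj⊎ : ∀ x → Σ (Fin (n + m)) (λ k → ⊎-Pointwise _≈ᴬ_ _≈ᴮ_ (enum⊎ k) x)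
  surj⊎ (inj₁ a) = let (i , e) = surj C a in
    i ↑ˡ m , subst (λ s → ⊎-Pointwise _≈ᴬ_ _≈ᴮ_ (enumSplit s) (inj₁ a)) (sym (splitAt-↑ˡ n i m)) (⊎P.inj₁ e)
  surj⊎ (inj₂ b) = let (j , e) = surj D b in
    n ↑ʳ j , subst (λ s → ⊎-Pointwise _≈ᴬ_ _≈ᴮ_ (enumSplit s) (inj₂ b)) (sym (splitAt-↑ʳ n m j)) (⊎P.inj₂ e)

Card-× : ∀ {A B : Set} {_≈ᴬ_ : A → A → Set} {_≈ᴮ_ : B → B → Set} {n m} →
  Card A _≈ᴬ_ n → Card B _≈ᴮ_ m → Card (A × B) (×-Pointwise _≈ᴬ_ _≈ᴮ_) (n * m)
Card-× {A} {B} {_≈ᴬ_} {_≈ᴮ_} {n} {m} C D = record { enum = enum× ; inj = inj× ; surj = surj× }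
  where
  enum× : Fin (n * m) → A × B
  enum× k = enum C (proj₁ (remQuot {n} m k)) , enum D (proj₂ (remQuot {n} m k))
  inj× : ∀ k k' → ×-Pointwise _≈ᴬ_ _≈ᴮ_ (enum× k) (enum× k') → k ≡ k'
  inj× k k' (e₁ , e₂) = begin
    k                                  ≡⟨ combine-remQuot {n} m k ⟨
    combine (proj₁ (remQuot {n} m k)) (proj₂ (remQuot {n} m k))
      ≡⟨ cong₂ combine (inj C _ _ e₁) (inj D _ _ e₂) ⟩
    combine (proj₁ (remQuot {n} m k')) (proj₂ (remQuot {n} m k'))
      ≡⟨ combine-remQuot {n} m k' ⟩
    k'                                 ∎
    where open ≡-Reasoning
  surj× : ∀ x → Σ (Fin (n * m)) (λ k → ×-Pointwise _≈ᴬ_ _≈ᴮ_ (enum× k) x)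
  surj× (a , b) = let (i , eᵢ) = surj C a ; (j , eⱼ) = surj D b in
    combine i j ,
    subst (λ p → ×-Pointwise _≈ᴬ_ _≈ᴮ_ (enum C (proj₁ p) , enum D (proj₂ p)) (a , b))
          (sym (remQuot-combine {k = m} i j)) (eᵢ , eⱼ)

data Fibrewise {n} {B : Fin n → Set} (_≈_ : ∀ {i} → B i → B i → Set) : Σ (Fin n) B → Σ (Fin n) B → Set where
  same-fibre : ∀ {i b b'} → b ≈ b' → Fibrewise _≈_ (i , b) (i , b')

Card-Σ : ∀ {n} {B : Fin n → Set} {_≈_ : ∀ {i} → B i → B i → Set} {m : Fin n → ℕ} →
  (∀ i → Card (B i) _≈_ (m i)) → Card (Σ (Fin n) B) (Fibrewise _≈_) (sum m)
Card-Σ {zero} _ = Card-empty λ ()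
Card-Σ {suc n} {B} {_≈_} Cs = Card-bijection (Card-⊎ (Cs zero) (Card-Σ (λ i → Cs (suc i)))) cons uncons cons-cong cons-reflects uncons-inverse
  where
  cons : B zero ⊎ Σ (Fin n) (λ i → B (suc i)) → Σ (Fin (suc n)) B
  cons (inj₁ b) = zero , b
  cons (inj₂ (i , b)) = suc i , b
  uncons : Σ (Fin (suc n)) B → B zero ⊎ Σ (Fin n) (λ i → B (suc i))
  uncons (zero , b) = inj₁ b
  uncons (suc i , b) = inj₂ (i , b)
  cons-cong : ∀ {x y} → ⊎-Pointwise _≈_ (Fibrewise _≈_) x y → Fibrewise _≈_ (cons x) (cons y)
  cons-cong (⊎P.inj₁ e) = same-fibre e
  cons-cong (⊎P.inj₂ (same-fibre e)) = same-fibre e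
  cons-reflects : ∀ {x y} → Fibrewise _≈_ (cons x) (cons y) → ⊎-Pointwise _≈_ (Fibrewise _≈_) x y
  cons-reflects {inj₁ _} {inj₁ _} (same-fibre e) = ⊎P.inj₁ e
  cons-reflects {inj₂ _} {inj₂ _} (same-fibre e) = ⊎P.inj₂ (same-fibre e)
  uncons-inverse : ∀ {a b} → ⊎-Pointwise _≈_ (Fibrewise _≈_) a (uncons b) → Fibrewise _≈_ (cons a) b
  uncons-inverse {_} {zero , _} (⊎P.inj₁ e) = same-fibre e
  uncons-inverse {_} {suc _ , _} (⊎P.inj₂ (same-fibre e)) = same-fibre e

Card-↔ : ∀ {A : Set} {_≈_ : A → A → Set} {n} → (∀ {x y} → x ≈ y → x ≡ y) → Card A _≈_ n → Fin n ↔ A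
Card-↔ ≈⇒≡ C = mk↔ₛ′ (enum C) (λ x → proj₁ (surj C x)) (λ x → ≈⇒≡ (proj₂ (surj C x)))
  (λ i → inj C _ _ (proj₂ (surj C (enum C i))))

Card-Dec : ∀ {P : Set} (d : Dec P) → Card P (λ _ _ → ⊤) (if does d then 1 else 0)
Card-Dec (yes p) = Card-singleton p (λ _ → tt)
Card-Dec (no ¬p) = Card-empty ¬p

module Counting {A : Set} (_≟_ : DecidableEquality A) where

  indicator : A → A → ℕ
  indicator x a = if does (x ≟ a) then 1 else 0

  count : ∀ {n} → (Fin n → A) → A → ℕ
  count f a = sum (λ i → indicator (f i) a)

  indicator-refl : ∀ a → indicator a a ≡ 1
  indicator-refl a with a ≟ a
  ... | yes _ = refl
  ... | no a≢a = ⊥-elim (a≢a refl)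

  indicator-≢ : ∀ {x a} → x ≢ a → indicator x a ≡ 0
  indicator-≢ {x} {a} x≢a with x ≟ a
  ... | yes x≡a = ⊥-elim (x≢a x≡a)
  ... | no _ = refl

  count-punchIn : ∀ {n} (f : Fin (suc n) → A) y a → count f a ≡ indicator (f y) a + count (λ i → f (punchIn y i)) a
  count-punchIn f y a = sum-remove {i = y} (λ i → indicator (f i) a)

  Card-fibre : ∀ {n} (f : Fin n → A) a → Card (Σ (Fin n) (λ i → f i ≡ a)) (λ x y → proj₁ x ≡ proj₁ y) (count f a)
  Card-fibre f a = Card-bijection (Card-Σ λ i → Card-Dec (f i ≟ a)) (λ x → x) (λ x → x) index-≡ ≡-index index-≡
    where
    index-≡ : ∀ {x y} → Fibrewise (λ _ _ → ⊤) x y → proj₁ x ≡ proj₁ y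
    index-≡ (same-fibre _) = refl
    ≡-index : ∀ {x y} → proj₁ x ≡ proj₁ y → Fibrewise (λ _ _ → ⊤) x y
    ≡-index {_ , _} {_ , _} refl = same-fibre tt

  count-suc⇒occurs : ∀ {n} (f : Fin n → A) a {k} → count f a ≡ suc k → Σ (Fin n) (λ i → f i ≡ a)
  count-suc⇒occurs f a e = enum (Card-fibre f a) (subst Fin (sym e) zero)

  count-tail : ∀ {n} (S S' : Fin (suc n) → A) y → S' y ≡ S zero → ∀ a → count S a ≡ count S' a →
               count (λ i → S (suc i)) a ≡ count (λ i → S' (punchIn y i)) a
  count-tail S S' y S'y≡S₀ a counts = +-cancelˡ-≡ (indicator (S zero) a) _ _ (begin
    indicator (S zero) a + count (λ i → S (suc i)) a        ≡⟨ counts ⟩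
    count S' a                                              ≡⟨ count-punchIn S' y a ⟩
    indicator (S' y) a + count (λ i → S' (punchIn y i)) a   ≡⟨ cong (λ x → indicator x a + count (λ i → S' (punchIn y i)) a) S'y≡S₀ ⟩
    indicator (S zero) a + count (λ i → S' (punchIn y i)) a ∎)
    where open ≡-Reasoning

  aligningPermutation : ∀ {n} (S S' : Fin n → A) → (∀ a → count S a ≡ count S' a) →
    Σ (Permutation′ n) (λ ρ → ∀ i → S i ≡ S' (ρ ⟨$⟩ʳ i))
  aligningPermutation {zero} S S' _ = idₚ , λ ()
  aligningPermutation {suc n} S S' counts = insert zero y ρ , λ { zero → sym S'y≡S₀ ; (suc i) → ρ-aligns i }
    where
    occurrence : Σ (Fin (suc n)) (λ i → S' i ≡ S zero)
    occurrence = count-suc⇒occurs S' (S zero)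
      (trans (sym (counts (S zero))) (cong (_+ count (λ i → S (suc i)) (S zero)) (indicator-refl (S zero))))
    y : Fin (suc n)
    y = proj₁ occurrence
    S'y≡S₀ : S' y ≡ S zero
    S'y≡S₀ = proj₂ occurrence
    tail-counts : ∀ a → count (λ i → S (suc i)) a ≡ count (λ i → S' (punchIn y i)) a
    tail-counts a = count-tail S S' y S'y≡S₀ a (counts a)
    ρ : Permutation′ n
    ρ = proj₁ (aligningPermutation (λ i → S (suc i)) (λ i → S' (punchIn y i)) tail-counts)
    ρ-aligns : ∀ i → S (suc i) ≡ S' (punchIn y (ρ ⟨$⟩ʳ i))
    ρ-aligns = proj₂ (aligningPermutation (λ i → S (suc i)) (λ i → S' (punchIn y i)) tail-counts)

open module CountingFin {c} = Counting (_≟ᶠ_ {c})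
module CountingBool = Counting _≟ᵇ_

count-false+true : ∀ {d} (S : Fin d → Bool) → CountingBool.count S false + CountingBool.count S true ≡ d
count-false+true {zero} S = refl
count-false+true {suc d} S with S zero
... | true = trans (+-suc _ _) (cong suc (count-false+true (S ∘ suc)))
... | false = cong suc (count-false+true (S ∘ suc))

prodFin≡product : ∀ {n} (f : Fin n → ℕ) → prodFin f ≡ product f
prodFin≡product {zero} f = refl
prodFin≡product {suc n} f = cong (f zero *_) (prodFin≡product (λ i → f (suc i)))

product-remove : ∀ {n} (f : Fin (suc n) → ℕ) i → product f ≡ f i * product (λ j → f (punchIn i j))
product-remove f i = Product.sum-remove {i = i} f

product-cong : ∀ {n} {f g : Fin n → ℕ} → (∀ i → f i ≡ g i) → product f ≡ product g
product-cong = Product.sum-cong-≗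

product-update : ∀ {c} (F F' : Fin c → ℕ) k₀ x → F k₀ ≡ x * F' k₀ → (∀ k → k₀ ≢ k → F k ≡ F' k) →
  product F ≡ x * product F'
product-update {suc c} F F' k₀ x at-k₀ elsewhere = begin
  product F                                         ≡⟨ product-remove F k₀ ⟩
  F k₀ * product (λ j → F (punchIn k₀ j))           ≡⟨ cong₂ _*_ at-k₀ (product-cong λ j → elsewhere _ (punchInᵢ≢i k₀ j ∘ sym)) ⟩
  x * F' k₀ * product (λ j → F' (punchIn k₀ j))     ≡⟨ *-assoc x _ _ ⟩
  x * (F' k₀ * product (λ j → F' (punchIn k₀ j)))   ≡⟨ cong (x *_) (product-remove F' k₀) ⟨
  x * product F'                                    ∎
  where open ≡-Reasoning

product-count : ∀ {n c} (cl : Fin n → Fin c) (G : Fin c → ℕ) →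
  product (λ i → G (cl i)) ≡ product (λ k → G k ^ count cl k)
product-count {zero} {c} cl G = sym (Product.sum-replicate-zero c)
product-count {suc n} cl G = begin
  G (cl zero) * product (λ i → G (cl (suc i)))               ≡⟨ cong (G (cl zero) *_) (product-count (λ i → cl (suc i)) G) ⟩
  G (cl zero) * product (λ k → G k ^ count (λ i → cl (suc i)) k) ≡⟨ product-update _ _ (cl zero) (G (cl zero)) at-cl₀ elsewhere ⟨
  product (λ k → G k ^ count cl k)                            ∎
  where
  open ≡-Reasoning
  at-cl₀ : G (cl zero) ^ count cl (cl zero) ≡ G (cl zero) * G (cl zero) ^ count (λ i → cl (suc i)) (cl zero)
  at-cl₀ = cong (λ m → G (cl zero) ^ (m + count (λ i → cl (suc i)) (cl zero))) (indicator-refl (cl zero))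
  elsewhere : ∀ k → cl zero ≢ k → G k ^ count cl k ≡ G k ^ count (λ i → cl (suc i)) k
  elsewhere k ne = cong (λ m → G k ^ (m + count (λ i → cl (suc i)) k)) (indicator-≢ ne)

factorial-power-suc : ∀ a h → suc a ! * h ^ suc a ≡ suc a * h * (a ! * h ^ a)
factorial-power-suc a h = rearrange (suc a) (a !) h (h ^ a)
  where
  rearrange : ∀ s f x p → (s * f) * (x * p) ≡ (s * x) * (f * p)
  rearrange = solve-∀

product-factorial-power-step : ∀ {c} (a a' h : Fin c → ℕ) k₀ → a k₀ ≡ suc (a' k₀) → (∀ k → k₀ ≢ k → a k ≡ a' k) →
  product (λ k → a k ! * h k ^ a k) ≡ a k₀ * h k₀ * product (λ k → a' k ! * h k ^ a' k)
product-factorial-power-step a a' h k₀ at-k₀ elsewhere = product-update _ _ k₀ (a k₀ * h k₀)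
  (begin
    a k₀ ! * h k₀ ^ a k₀                          ≡⟨ cong (λ m → m ! * h k₀ ^ m) at-k₀ ⟩
    suc (a' k₀) ! * h k₀ ^ suc (a' k₀)            ≡⟨ factorial-power-suc (a' k₀) (h k₀) ⟩
    suc (a' k₀) * h k₀ * (a' k₀ ! * h k₀ ^ a' k₀)  ≡⟨ cong (λ m → m * h k₀ * _) at-k₀ ⟨
    a k₀ * h k₀ * (a' k₀ ! * h k₀ ^ a' k₀)         ∎)
  (λ k ne → cong (λ m → m ! * h k ^ m) (elsewhere k ne))
  where open ≡-Reasoning

-- Permutations decorated by class-respecting fillings

Filling : (X : Set) → (X → X → Set) → Set
Filling X H = Σ (X ↔ X) (λ σ → ∀ x → H x (↔.to σ x))

FillingEq : ∀ {X} {H : X → X → Set} → (∀ x y y' → H x y → H x y' → Set) → Filling X H → Filling X H → Set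
FillingEq R (σ , F) (σ' , F') = (∀ x → ↔.to σ x ≡ ↔.to σ' x) × (∀ x → R x _ _ (F x) (F' x))

-- Choosing the image y of row zero leaves a filling of the minor without row zero and column y.
module FillingStep {n} (H : Fin (suc n) → Fin (suc n) → Set) (R : ∀ i j j' → H i j → H i j' → Set) where

  Minor : Fin (suc n) → Fin n → Fin n → Set
  Minor y i j = H (suc i) (punchIn y j)

  MinorEq : ∀ y i j j' → Minor y i j → Minor y i j' → Set
  MinorEq y i j j' = R (suc i) (punchIn y j) (punchIn y j')

  Expansion : Fin (suc n) → Set
  Expansion y = H zero y × Filling (Fin n) (Minor y)

  ExpansionEq : ∀ {y} → Expansion y → Expansion y → Set
  ExpansionEq {y} = ×-Pointwise (R zero y y) (FillingEq (MinorEq y))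

  expand : Σ (Fin (suc n)) Expansion → Filling (Fin (suc n)) H
  expand (y , a , σ , F) = insert zero y σ , λ { zero → a ; (suc i) → F i }

  contract : Filling (Fin (suc n)) H → Σ (Fin (suc n)) Expansion
  contract (π , F) = π ⟨$⟩ʳ zero , F zero , remove zero π ,
    λ i → subst (H (suc i)) (punchIn-permute π zero i) (F (suc i))

  expand-cong : ∀ {x y} → Fibrewise ExpansionEq x y → FillingEq R (expand x) (expand y)
  expand-cong (same-fibre (a≈ , σ≈ , F≈)) =
    (λ { zero → refl ; (suc i) → cong (punchIn _) (σ≈ i) }) , λ { zero → a≈ ; (suc i) → F≈ i }

  expand-reflects : ∀ {x y} → FillingEq R (expand x) (expand y) → Fibrewise ExpansionEq x y
  expand-reflects {y , _} {_ , _} (σ≈ , F≈) with σ≈ zero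
  ... | refl = same-fibre (F≈ zero , (λ i → punchIn-injective y _ _ (σ≈ (suc i))) , (λ i → F≈ (suc i)))

  R-subst : ∀ {i j j' j''} (e : j' ≡ j'') {x : H i j} {y : H i j'} → R i j j'' x (subst (H i) e y) → R i j j' x y
  R-subst refl r = r

  contract-inverse : ∀ {x f} → Fibrewise ExpansionEq x (contract f) → FillingEq R (expand x) f
  contract-inverse {_} {π , F} (same-fibre (a≈ , σ≈ , F≈)) =
    (λ { zero → refl ; (suc i) → trans (cong (punchIn _) (σ≈ i)) (sym (punchIn-permute π zero i)) }) ,
    λ { zero → a≈ ; (suc i) → R-subst (punchIn-permute π zero i) (F≈ i) }

  Card-expansion : ∀ {m} → Card (Σ (Fin (suc n)) Expansion) (Fibrewise ExpansionEq) m → Card (Filling (Fin (suc n)) H) (FillingEq R) m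
  Card-expansion C = Card-bijection C expand contract expand-cong expand-reflects
    (λ {x} {f} → contract-inverse {x} {f})

Card-Filling : ∀ {n c} (rowClass colClass : Fin n → Fin c) (H : Fin n → Fin n → Set)
  (R : ∀ i j j' → H i j → H i j' → Set) (h : Fin c → ℕ) →
  (∀ k → count rowClass k ≡ count colClass k) →
  (∀ i j → rowClass i ≡ colClass j → Card (H i j) (R i j j) (h (rowClass i))) →
  (∀ i j → rowClass i ≢ colClass j → ¬ H i j) →
  Card (Filling (Fin n) H) (FillingEq R) (product (λ k → count rowClass k ! * h k ^ count rowClass k))
Card-Filling {zero} {c} _ _ _ _ _ _ _ _ =
  subst (Card _ _) (sym (Product.sum-replicate-zero c)) (Card-singleton (idₚ , λ ()) (λ _ → (λ ()) , (λ ())))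
Card-Filling {suc n} {c} rowClass colClass H R h counts same different =
  subst (Card _ _) size (Card-expansion (Card-Σ fibre))
  where
  open FillingStep H R
  k₀ : Fin c
  k₀ = rowClass zero
  rest : Fin c → ℕ
  rest = count (λ i → rowClass (suc i))
  K : ℕ
  K = h k₀ * product (λ k → rest k ! * h k ^ rest k)
  fibre : ∀ y → Card (Expansion y) ExpansionEq (indicator (colClass y) k₀ * K)
  fibre y with colClass y ≟ᶠ k₀
  ... | yes e = subst (Card _ _) (sym (+-identityʳ K))
    (Card-× (same zero y (sym e))
            (Card-Filling (λ i → rowClass (suc i)) (λ j → colClass (punchIn y j)) (Minor y) (MinorEq y) h
               (λ k → count-tail rowClass colClass y e k (counts k))
               (λ i j → same (suc i) (punchIn y j)) (λ i j → different (suc i) (punchIn y j))))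
  ... | no ne = Card-empty (different zero y (ne ∘ sym) ∘ proj₁)
  size : sum (λ y → indicator (colClass y) k₀ * K) ≡ product (λ k → count rowClass k ! * h k ^ count rowClass k)
  size = begin
    sum (λ y → indicator (colClass y) k₀ * K)   ≡⟨ *-distribʳ-sum K (λ y → indicator (colClass y) k₀) ⟨
    count colClass k₀ * K                       ≡⟨ cong (_* K) (counts k₀) ⟨
    count rowClass k₀ * K                       ≡⟨ *-assoc (count rowClass k₀) _ _ ⟨
    count rowClass k₀ * h k₀ * product (λ k → rest k ! * h k ^ rest k)
      ≡⟨ product-factorial-power-step (count rowClass) rest h k₀
           (cong (_+ rest k₀) (indicator-refl k₀)) (λ k ne → cong (_+ rest k) (indicator-≢ ne)) ⟨
    product (λ k → count rowClass k ! * h k ^ count rowClass k) ∎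
    where open ≡-Reasoning

module Relabel {X : Set} {n} (e : Fin n ↔ X) (H : X → X → Set) (R : ∀ x y y' → H x y → H x y' → Set) where

  private
    ⌜_⌝ : Fin n → X
    ⌜ i ⌝ = ↔.to e i
    index : X → Fin n
    index = ↔.from e
    ⌜index⌝ : ∀ x → ⌜ index x ⌝ ≡ x
    ⌜index⌝ = ↔.strictlyInverseˡ e
    index⌜⌝ : ∀ i → index ⌜ i ⌝ ≡ i
    index⌜⌝ = ↔.strictlyInverseʳ e

  IndexedFilling : Set
  IndexedFilling = Filling (Fin n) (λ i j → H ⌜ i ⌝ ⌜ j ⌝)

  IndexedFillingEq : IndexedFilling → IndexedFilling → Set
  IndexedFillingEq = FillingEq (λ i j j' → R ⌜ i ⌝ ⌜ j ⌝ ⌜ j' ⌝)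

  relabel : IndexedFilling → Filling X H
  relabel (σ , F) = ↔-trans (↔-sym e) (↔-trans σ e) ,
    λ x → subst (λ z → H z ⌜ ↔.to σ (index x) ⌝) (⌜index⌝ x) (F (index x))

  unlabel : Filling X H → IndexedFilling
  unlabel (π , G) = ↔-trans e (↔-trans π (↔-sym e)) , λ i → subst (H ⌜ i ⌝) (sym (⌜index⌝ _)) (G ⌜ i ⌝)

  R-subst-row : ∀ {z x} (p : z ≡ x) {y y'} {h : H z y} {h' : H z y'} → R z y y' h h' →
    R x y y' (subst (λ w → H w y) p h) (subst (λ w → H w y') p h')
  R-subst-row refl r = r

  R-subst-column : ∀ {x y y' y''} (q : y'' ≡ y') {h : H x y} {h' : H x y'} → R x y y'' h (subst (H x) (sym q) h') → R x y y' h h'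
  R-subst-column refl r = r

  relabel-cong : ∀ {a b} → IndexedFillingEq a b → FillingEq R (relabel a) (relabel b)
  relabel-cong (σ≈ , F≈) = (λ x → cong ⌜_⌝ (σ≈ (index x))) , λ x → R-subst-row (⌜index⌝ x) (F≈ (index x))

  relabel-reflects : ∀ {a b} → FillingEq R (relabel a) (relabel b) → IndexedFillingEq a b
  relabel-reflects {σ , F} {σ' , F'} (π≈ , G≈) = σ≈ , λ i → unrelabel (index⌜⌝ i) (⌜index⌝ ⌜ i ⌝) (G≈ ⌜ i ⌝)
    where
    σ≈ : ∀ i → ↔.to σ i ≡ ↔.to σ' i
    σ≈ i = begin
      ↔.to σ i                       ≡⟨ cong (↔.to σ) (index⌜⌝ i) ⟨
      ↔.to σ (index ⌜ i ⌝)           ≡⟨ index⌜⌝ _ ⟨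
      index ⌜ ↔.to σ (index ⌜ i ⌝) ⌝   ≡⟨ cong index (π≈ ⌜ i ⌝) ⟩
      index ⌜ ↔.to σ' (index ⌜ i ⌝) ⌝  ≡⟨ index⌜⌝ _ ⟩
      ↔.to σ' (index ⌜ i ⌝)          ≡⟨ cong (↔.to σ') (index⌜⌝ i) ⟩
      ↔.to σ' i                      ∎
      where open ≡-Reasoning
    unrelabel : ∀ {j i} (p : j ≡ i) (q : ⌜ j ⌝ ≡ ⌜ i ⌝) →
      R ⌜ i ⌝ _ _ (subst (λ w → H w ⌜ ↔.to σ j ⌝) q (F j)) (subst (λ w → H w ⌜ ↔.to σ' j ⌝) q (F' j)) →
      R ⌜ i ⌝ _ _ (F i) (F' i)
    unrelabel refl refl r = r

  unlabel-inverse : ∀ {a b} → IndexedFillingEq a (unlabel b) → FillingEq R (relabel a) b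
  unlabel-inverse {σ , F} {π , G} (σ≈ , F≈) =
    (λ x → trans (cong ⌜_⌝ (σ≈ (index x))) (trans (⌜index⌝ _) (cong (↔.to π) (⌜index⌝ x)))) ,
    λ x → R-unsubst-row (⌜index⌝ x) (relabel-unlabel (index x) x (⌜index⌝ x))
    where
    R-unsubst-row : ∀ {z x} (p : z ≡ x) {y y'} {h : H x y} {h' : H x y'} →
      R z y y' (subst (λ w → H w y) (sym p) h) (subst (λ w → H w y') (sym p) h') → R x y y' h h'
    R-unsubst-row refl r = r
    relabel-unlabel : ∀ i x (p : ⌜ i ⌝ ≡ x) →
      R ⌜ i ⌝ _ _ (subst (λ w → H w ⌜ ↔.to σ i ⌝) (sym p) (subst (λ w → H w ⌜ ↔.to σ i ⌝) p (F i)))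
                  (subst (λ w → H w (↔.to π x)) (sym p) (G x))
    relabel-unlabel i _ refl = R-subst-column (⌜index⌝ _) (F≈ i)

  Card-relabel : ∀ {m} → Card IndexedFilling IndexedFillingEq m → Card (Filling X H) (FillingEq R) m
  Card-relabel C = Card-bijection C relabel unlabel (λ {a} {b} → relabel-cong {a} {b}) (λ {a} {b} → relabel-reflects {a} {b})
    (λ {a} {b} → unlabel-inverse {a} {b})

open Relabel using (Card-relabel)

open RootedGraph

Iso-refl : ∀ {G} → Iso G G
Iso-refl = record
  { to = λ x → x ; from = λ x → x ; from-to = λ _ → refl ; to-from = λ _ → refl
  ; root-pres = refl ; adj-pres = λ _ _ a → a ; adj-refl = λ _ _ a → a }

Iso-sym : ∀ {G H} → Iso G H → Iso H G
Iso-sym {G} {H} f = record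
  { to = from f ; from = to f ; from-to = to-from f ; to-from = from-to f
  ; root-pres = trans (cong (from f) (sym (root-pres f))) (from-to f (rt G))
  ; adj-pres = λ x y a → adj-refl f (from f x) (from f y) (subst₂ (Adj H) (sym (to-from f x)) (sym (to-from f y)) a)
  ; adj-refl = λ x y a → subst₂ (Adj H) (to-from f x) (to-from f y) (adj-pres f (from f x) (from f y) a) }

Iso-trans : ∀ {G H K} → Iso G H → Iso H K → Iso G K
Iso-trans f g = record
  { to = λ x → to g (to f x) ; from = λ z → from f (from g z)
  ; from-to = λ x → trans (cong (from f) (from-to g (to f x))) (from-to f x)
  ; to-from = λ z → trans (cong (to g) (to-from f (from g z))) (to-from g z)
  ; root-pres = trans (cong (to g) (root-pres f)) (root-pres g)
  ; adj-pres = λ x y a → adj-pres g _ _ (adj-pres f x y a)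
  ; adj-refl = λ x y a → adj-refl f x y (adj-refl g _ _ a) }

Σ-T-≡ : ∀ {X : Set} {P : X → Bool} {x y : Σ X (T ∘ P)} → proj₁ x ≡ proj₁ y → x ≡ y
Σ-T-≡ {x = v , p} {.v , q} refl = cong (v ,_) (T-irrelevant p q)

vertex-≡ : ∀ {d m} (A : Subtree d m) {x y : V (SubG A)} → proj₁ x ≡ proj₁ y → x ≡ y
vertex-≡ A = Σ-T-≡

firstLevel-≡ : ∀ {d m} (A : Subtree d (suc m)) {x y : FirstLevel A} → proj₁ x ≡ proj₁ y → x ≡ y
firstLevel-≡ A = Σ-T-≡

module _ {d : ℕ} where

  child-injectiveˡ : ∀ {m} {c c' : Fin d} {v v' : Vtx d m} → child c v ≡ child c' v' → c ≡ c'
  child-injectiveˡ refl = refl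

  child-injectiveʳ : ∀ {m} {c c' : Fin d} {v v' : Vtx d m} → child c v ≡ child c' v' → v ≡ v'
  child-injectiveʳ refl = refl

  Parent-root : ∀ {m} {y : Vtx d (suc m)} → Parent root y → Σ (Fin d) (λ c → y ≡ child c root)
  Parent-root (here c) = c , refl

  ¬Parent-root : ∀ {m} {x : Vtx d m} → ¬ Parent x root
  ¬Parent-root ()

  unthere : ∀ {m} {c c' : Fin d} {a b : Vtx d m} → Parent (child c a) (child c' b) → Parent a b
  unthere (there c p) = p

  TAdj-child : ∀ {m} (c : Fin d) {a b : Vtx d m} → TAdj a b → TAdj (child c a) (child c b)
  TAdj-child c (inj₁ p) = inj₁ (there c p)
  TAdj-child c (inj₂ p) = inj₂ (there c p)

  TAdj-unchild : ∀ {m} {c c' : Fin d} {a b : Vtx d m} → TAdj (child c a) (child c' b) → TAdj a b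
  TAdj-unchild (inj₁ p) = inj₁ (unthere p)
  TAdj-unchild (inj₂ p) = inj₂ (unthere p)

  TAdj-head : ∀ {m} {c c' : Fin d} {a b : Vtx d m} → TAdj (child c a) (child c' b) → c ≡ c'
  TAdj-head (inj₁ (there _ _)) = refl
  TAdj-head (inj₂ (there _ _)) = refl

  Parent-root-child : ∀ {m} {c : Fin d} {w : Vtx d m} → Parent root (child c w) → w ≡ root
  Parent-root-child (here _) = refl

  TAdj-root : ∀ {m} {y : Vtx d (suc m)} → TAdj root y → Σ (Fin d) (λ c → y ≡ child c root)
  TAdj-root (inj₁ p) = Parent-root p
  TAdj-root (inj₂ ())

  Under : ∀ {m} → Fin d → Vtx d (suc m) → Set
  Under {m} c u = Σ (Vtx d m) (λ w → u ≡ child c w)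

  Under-adjacent : ∀ {m} {c} {u u' : Vtx d (suc m)} → Under c u → TAdj u u' → u' ≢ root → Under c u'
  Under-adjacent (_ , refl) (inj₁ (there c _)) _ = _ , refl
  Under-adjacent (_ , refl) (inj₂ (here _)) u'≢root = ⊥-elim (u'≢root refl)
  Under-adjacent (_ , refl) (inj₂ (there c _)) _ = _ , refl

  -- A vertex lists its path starting next to the root, so structural induction peels off steps near the root; a prefix context remembers the steps peeled off.
  PrefixContext : ℕ → ℕ → Set
  PrefixContext k M = Σ (Vtx d k → Vtx d M) (λ ctx → ∀ {a b} → Parent a b → Parent (ctx a) (ctx b))

  extend : ∀ {k M} → PrefixContext (suc k) M → Fin d → PrefixContext k M
  extend (ctx , ctx-parent) e = (λ v → ctx (child e v)) , (λ p → ctx-parent (there e p))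

  prefix∈ : ∀ {k M} (A : Subtree d M) ((ctx , _) : PrefixContext k M) v → T (mem A (ctx v)) → T (mem A (ctx root))
  prefix∈ A _ root r = r
  prefix∈ A (ctx , ctx-parent) (child e w) r = closed A (ctx-parent (here e)) (prefix∈ A (extend (ctx , ctx-parent) e) w r)

  branch-root∈ : ∀ {m} (A : Subtree d (suc m)) c v → T (mem A (child c v)) → T (mem A (child c root))
  branch-root∈ A c = prefix∈ A (child c , there c)

module Decomposition {d m : ℕ} (A B : Subtree d (suc m)) (φ : Iso (SubG A) (SubG B)) where

  φ· : ∀ v → T (mem A v) → Vtx d (suc m)
  φ· v r = proj₁ (to φ (v , r))

  φ·-irrelevant : ∀ v r r' → φ· v r ≡ φ· v r'
  φ·-irrelevant v r r' = cong (φ· v) (T-irrelevant r r')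

  φ·-root : ∀ r → φ· root r ≡ root
  φ·-root r = trans (φ·-irrelevant root r (root∈ A)) (cong proj₁ (root-pres φ))

  φ·-nonroot : ∀ v r → φ· v r ≡ root → v ≡ root
  φ·-nonroot v r e = cong proj₁ (begin
    (v , r)                          ≡⟨ from-to φ (v , r) ⟨
    from φ (to φ (v , r))            ≡⟨ cong (from φ) (vertex-≡ B (trans e (sym (φ·-root (root∈ A))))) ⟩
    from φ (to φ (root , root∈ A))   ≡⟨ from-to φ (root , root∈ A) ⟩
    (root , root∈ A)                 ∎)
    where open ≡-Reasoning

  φ·-adjacent : ∀ {u v} r s → TAdj u v → TAdj (φ· u r) (φ· v s)
  φ·-adjacent r s = adj-pres φ (_ , r) (_ , s)

  firstLevelImage : ∀ c p → Σ (Fin d) (λ c' → φ· (child c root) p ≡ child c' root)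
  firstLevelImage c p = TAdj-root (subst (λ z → TAdj z (φ· (child c root) p)) (φ·-root (root∈ A))
                                         (φ·-adjacent (root∈ A) p (inj₁ (here c))))

  head : FirstLevel A → Fin d
  head (c , p) = proj₁ (firstLevelImage c p)

  head-spec : ∀ c p → φ· (child c root) p ≡ child (head (c , p)) root
  head-spec c p = proj₂ (firstLevelImage c p)

  -- φ sends adjacent non-root vertices to adjacent non-root vertices, so the images of a path leaving ctx root stay below one first-level vertex.
  under-prefix : ∀ {k} (ctx : PrefixContext k (suc m)) {c'} v r r₀ →
    Under c' (φ· (proj₁ ctx root) r₀) → Under c' (φ· (proj₁ ctx v) r)
  under-prefix _ root r r₀ u = subst (Under _) (φ·-irrelevant _ r₀ r) u
  under-prefix (ctx , ctx-parent) (child e w) r r₀ u =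
    under-prefix (extend (ctx , ctx-parent) e) w r r₁ (Under-adjacent u (φ·-adjacent r₀ r₁ (inj₁ (ctx-parent (here e)))) nonroot)
    where
    r₁ : T (mem A (ctx (child e root)))
    r₁ = prefix∈ A (extend (ctx , ctx-parent) e) w r
    nonroot : φ· (ctx (child e root)) r₁ ≢ root
    nonroot e' = ¬Parent-root (subst (Parent _) (φ·-nonroot _ r₁ e') (ctx-parent (here e)))

  descend : ∀ c p v r → Under (head (c , p)) (φ· (child c v) r)
  descend c p v r = under-prefix (child c , there c) v r p (root , head-spec c p)

  firstLevelTo : FirstLevel A → FirstLevel B
  firstLevelTo (c , p) = head (c , p) , subst (T ∘ mem B) (head-spec c p) (proj₂ (to φ (child c root , p)))

  branchTo : ∀ x (y : FirstLevel B) → proj₁ y ≡ head x → V (SubG (branch A x)) → V (SubG (branch B y))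
  branchTo (c , p) (c' , q) e (v , r) = proj₁ (descend c p v r) ,
    subst (T ∘ mem B) (trans (proj₂ (descend c p v r)) (cong (λ k → child k _) (sym e))) (proj₂ (to φ (child c v , r)))

  branchTo-spec : ∀ x y e v r → child (proj₁ y) (proj₁ (branchTo x y e (v , r))) ≡ φ· (child (proj₁ x) v) r
  branchTo-spec (c , p) (c' , q) e v r = sym (trans (proj₂ (descend c p v r)) (cong (λ k → child k _) (sym e)))

head-unique : ∀ {d m} (A B : Subtree d (suc m)) (φ ψ : Iso (SubG A) (SubG B)) → (∀ x → to φ x ≡ to ψ x) →
  ∀ x → Decomposition.head A B φ x ≡ Decomposition.head A B ψ x
head-unique A B φ ψ φ≡ψ (c , p) = child-injectiveˡ (begin
  child (Φ.head (c , p)) root   ≡⟨ Φ.head-spec c p ⟨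
  Φ.φ· (child c root) p         ≡⟨ cong proj₁ (φ≡ψ (child c root , p)) ⟩
  Ψ.φ· (child c root) p         ≡⟨ Ψ.head-spec c p ⟩
  child (Ψ.head (c , p)) root   ∎)
  where
  module Φ = Decomposition A B φ
  module Ψ = Decomposition A B ψ
  open ≡-Reasoning

head-sym : ∀ {d m} (A B : Subtree d (suc m)) (φ : Iso (SubG A) (SubG B)) x q →
  Decomposition.head B A (Iso-sym φ) (Decomposition.head A B φ x , q) ≡ proj₁ x
head-sym A B φ (c , p) q = sym (child-injectiveˡ (begin
  child c root                                         ≡⟨ cong proj₁ (from-to φ (child c root , p)) ⟨
  proj₁ (from φ (to φ (child c root , p)))             ≡⟨ cong (proj₁ ∘ from φ) (vertex-≡ B (Φ.head-spec c p)) ⟩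
  Φ⁻¹.φ· (child (Φ.head (c , p)) root) q               ≡⟨ Φ⁻¹.head-spec _ q ⟩
  child (Φ⁻¹.head (Φ.head (c , p) , q)) root           ∎))
  where
  module Φ = Decomposition A B φ
  module Φ⁻¹ = Decomposition B A (Iso-sym φ)
  open ≡-Reasoning

module Branches {d m : ℕ} (A B : Subtree d (suc m)) (φ : Iso (SubG A) (SubG B)) where
  open Decomposition A B φ public
  private
    module Inv = Decomposition B A (Iso-sym φ)

  head-inverseˡ : ∀ c' q p → head (Inv.head (c' , q) , p) ≡ c'
  head-inverseˡ c' q p = trans (head-unique A B φ (Iso-sym (Iso-sym φ)) (λ _ → refl) _) (head-sym B A (Iso-sym φ) (c' , q) p)

  firstLevel↔ : FirstLevel A ↔ FirstLevel B
  firstLevel↔ = mk↔ₛ′ firstLevelTo Inv.firstLevelTo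
    (λ { (c' , q) → firstLevel-≡ B (head-inverseˡ c' q _) })
    (λ { (c , p) → firstLevel-≡ A (head-sym A B φ (c , p) _) })

  branchIso : ∀ x → Iso (SubG (branch A x)) (SubG (branch B (firstLevelTo x)))
  branchIso (c , p) = record
    { to        = to′
    ; from      = from′
    ; from-to   = λ { (v , r) → vertex-≡ (branch A (c , p)) (child-injectiveʳ (from-to′ v r)) }
    ; to-from   = λ { (w , s) → vertex-≡ (branch B (firstLevelTo (c , p))) (child-injectiveʳ (to-from′ w s)) }
    ; root-pres = vertex-≡ (branch B (firstLevelTo (c , p))) (child-injectiveʳ (trans (to-spec root p) (head-spec c p)))
    ; adj-pres  = λ { (v , r) (w , s) a → TAdj-unchild (subst₂ TAdj (sym (to-spec v r)) (sym (to-spec w s))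
                                                                     (φ·-adjacent r s (TAdj-child c a))) }
    ; adj-refl  = λ { (v , r) (w , s) a → TAdj-unchild (adj-refl φ (child c v , r) (child c w , s)
                                             (subst₂ TAdj (to-spec v r) (to-spec w s) (TAdj-child (head (c , p)) a))) }
    }
    where
    x : FirstLevel A
    x = (c , p)
    to′ : V (SubG (branch A x)) → V (SubG (branch B (firstLevelTo x)))
    to′ = branchTo x (firstLevelTo x) refl
    back : c ≡ Inv.head (firstLevelTo x)
    back = sym (head-sym A B φ x _)
    from′ : V (SubG (branch B (firstLevelTo x))) → V (SubG (branch A x))
    from′ = Inv.branchTo (firstLevelTo x) x back
    to-spec : ∀ v r → child (head x) (proj₁ (to′ (v , r))) ≡ φ· (child c v) r
    to-spec v r = branchTo-spec x (firstLevelTo x) refl v r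
    from-spec : ∀ w s → child c (proj₁ (from′ (w , s))) ≡ Inv.φ· (child (head x) w) s
    from-spec w s = Inv.branchTo-spec (firstLevelTo x) x back w s
    from-to′ : ∀ v r → child c (proj₁ (from′ (to′ (v , r)))) ≡ child c v
    from-to′ v r = begin
      child c (proj₁ (from′ (to′ (v , r))))       ≡⟨ from-spec _ _ ⟩
      Inv.φ· (child (head x) _) _                  ≡⟨ cong (proj₁ ∘ from φ) (vertex-≡ B (to-spec v r)) ⟩
      proj₁ (from φ (to φ (child c v , r)))        ≡⟨ cong proj₁ (from-to φ _) ⟩
      child c v                                    ∎
      where open ≡-Reasoning
    to-from′ : ∀ w s → child (head x) (proj₁ (to′ (from′ (w , s)))) ≡ child (head x) w
    to-from′ w s = begin
      child (head x) (proj₁ (to′ (from′ (w , s))))  ≡⟨ to-spec _ _ ⟩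
      φ· (child c _) _                               ≡⟨ cong (proj₁ ∘ to φ) (vertex-≡ A (from-spec w s)) ⟩
      proj₁ (to φ (from φ (child (head x) w , s)))   ≡⟨ cong proj₁ (to-from φ _) ⟩
      child (head x) w                               ∎
      where open ≡-Reasoning

  decompose-spec : ∀ x v r → φ· (child (proj₁ x) v) r ≡ child (head x) (proj₁ (to (branchIso x) (v , r)))
  decompose-spec x v r = sym (branchTo-spec x (firstLevelTo x) refl v r)

module Glue {d m : ℕ} (A B : Subtree d (suc m)) (π : FirstLevel A ↔ FirstLevel B)
  (F : ∀ x → Iso (SubG (branch A x)) (SubG (branch B (↔.to π x)))) where

  F· : ∀ x v → T (mem A (child (proj₁ x) v)) → Vtx d m
  F· x v r = proj₁ (to (F x) (v , r))

  F·-cong : ∀ {x x'} → x ≡ x' → ∀ v r r' → F· x v r ≡ F· x' v r'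
  F·-cong {x} refl v r r' = cong (F· x v) (T-irrelevant r r')

  F⁻¹·-cong : ∀ {x x'} → x ≡ x' → ∀ w s s' → proj₁ (from (F x) (w , s)) ≡ proj₁ (from (F x') (w , s'))
  F⁻¹·-cong {x} refl w s s' = cong (λ z → proj₁ (from (F x) (w , z))) (T-irrelevant s s')

  F·-root : ∀ x → F· x root (proj₂ x) ≡ root
  F·-root x = cong proj₁ (root-pres (F x))

  F·-nonroot : ∀ x v r → F· x v r ≡ root → v ≡ root
  F·-nonroot x v r e = cong proj₁ (begin
    (v , r)                                ≡⟨ from-to (F x) (v , r) ⟨
    from (F x) (to (F x) (v , r))          ≡⟨ cong (from (F x)) (vertex-≡ (branch B (↔.to π x)) (trans e (sym (F·-root x)))) ⟩
    from (F x) (to (F x) (root , proj₂ x)) ≡⟨ from-to (F x) (root , proj₂ x) ⟩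
    (root , proj₂ x)                       ∎)
    where open ≡-Reasoning

  at : ∀ c v → T (mem A (child c v)) → FirstLevel A
  at c v r = c , branch-root∈ A c v r

  glueTo : V (SubG A) → V (SubG B)
  glueTo (root , _) = root , root∈ B
  glueTo (child c v , r) = child (proj₁ (↔.to π (at c v r))) (F· (at c v r) v r) , proj₂ (to (F (at c v r)) (v , r))

  glueFrom : V (SubG B) → V (SubG A)
  glueFrom (root , _) = root , root∈ A
  glueFrom (child c' w , s) = child (proj₁ x) (proj₁ (from (F x) (w , s'))) , proj₂ (from (F x) (w , s'))
    where
    x : FirstLevel A
    x = ↔.from π (c' , branch-root∈ B c' w s)
    s' : T (mem B (child (proj₁ (↔.to π x)) w))
    s' = subst (λ k → T (mem B (child k w))) (sym (cong proj₁ (↔.strictlyInverseˡ π _))) s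

  child-F·-cong : ∀ {x x'} → x ≡ x' → ∀ v r r' →
    child (proj₁ (↔.to π x)) (F· x v r) ≡ child (proj₁ (↔.to π x')) (F· x' v r')
  child-F·-cong refl v r r' = cong (child _) (F·-cong refl v r r')

  glueTo-child : ∀ x v r → proj₁ (glueTo (child (proj₁ x) v , r)) ≡ child (proj₁ (↔.to π x)) (F· x v r)
  glueTo-child (c , p) v r = child-F·-cong (firstLevel-≡ A refl) v r r

  glueFrom-glueTo : ∀ z → glueFrom (glueTo z) ≡ z
  glueFrom-glueTo (root , r) = vertex-≡ A refl
  glueFrom-glueTo (child c v , r) = vertex-≡ A (cong₂ child (cong proj₁ x≡) (begin
    proj₁ (from (F _) (F· x v r , _))              ≡⟨ F⁻¹·-cong x≡ _ _ (proj₂ (to (F x) (v , r))) ⟩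
    proj₁ (from (F x) (to (F x) (v , r)))          ≡⟨ cong proj₁ (from-to (F x) (v , r)) ⟩
    v                                              ∎))
    where
    open ≡-Reasoning
    x : FirstLevel A
    x = at c v r
    x≡ : ↔.from π (proj₁ (↔.to π x) , _) ≡ x
    x≡ = trans (cong (↔.from π) (firstLevel-≡ B refl)) (↔.strictlyInverseʳ π x)

  glueTo-glueFrom : ∀ z → glueTo (glueFrom z) ≡ z
  glueTo-glueFrom (root , s) = vertex-≡ B refl
  glueTo-glueFrom (child c' w , s) = vertex-≡ B (begin
    proj₁ (glueTo (glueFrom (child c' w , s)))            ≡⟨ child-F·-cong (firstLevel-≡ A refl) _ _ (proj₂ u) ⟩
    child (proj₁ (↔.to π x)) (proj₁ (to (F x) u))         ≡⟨ cong₂ child (cong proj₁ (↔.strictlyInverseˡ π y)) (cong proj₁ (to-from (F x) (w , s'))) ⟩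
    child c' w                                            ∎)
    where
    open ≡-Reasoning
    y : FirstLevel B
    y = c' , branch-root∈ B c' w s
    x : FirstLevel A
    x = ↔.from π y
    s' : T (mem B (child (proj₁ (↔.to π x)) w))
    s' = subst (λ k → T (mem B (child k w))) (sym (cong proj₁ (↔.strictlyInverseˡ π y))) s
    u : V (SubG (branch A x))
    u = from (F x) (w , s')

  glueTo-adjacent : ∀ a b → TAdj (proj₁ a) (proj₁ b) → TAdj (proj₁ (glueTo a)) (proj₁ (glueTo b))
  glueTo-adjacent (root , _) (root , _) (inj₁ ())
  glueTo-adjacent (root , _) (root , _) (inj₂ ())
  glueTo-adjacent (root , _) (child c v , r) (inj₁ (here .c)) =
    inj₁ (subst (λ z → Parent root (child (proj₁ (↔.to π (c , r))) z)) (sym (F·-root (c , r))) (here _))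
  glueTo-adjacent (child c v , r) (root , _) (inj₂ (here .c)) =
    inj₂ (subst (λ z → Parent root (child (proj₁ (↔.to π (c , r))) z)) (sym (F·-root (c , r))) (here _))
  glueTo-adjacent (child c v , r) (child c' v' , r') a with TAdj-head a
  ... | refl = subst₂ TAdj (sym (glueTo-child x v r)) (sym (glueTo-child x v' r'))
                 (TAdj-child _ (adj-pres (F x) (v , r) (v' , r') (TAdj-unchild a)))
    where
    x : FirstLevel A
    x = at c v r

  glueTo-reflects : ∀ a b → TAdj (proj₁ (glueTo a)) (proj₁ (glueTo b)) → TAdj (proj₁ a) (proj₁ b)
  glueTo-reflects (root , _) (root , _) (inj₁ ())
  glueTo-reflects (root , _) (root , _) (inj₂ ())
  glueTo-reflects (root , _) (child c v , r) (inj₁ p) with F·-nonroot (at c v r) v r (Parent-root-child p)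
  ... | refl = inj₁ (here c)
  glueTo-reflects (child c v , r) (root , _) (inj₂ p) with F·-nonroot (at c v r) v r (Parent-root-child p)
  ... | refl = inj₂ (here c)
  glueTo-reflects (child c v , r) (child c' v' , r') a with cong proj₁ (Injection.injective (↔⇒↣ π) (firstLevel-≡ B (TAdj-head a)))
  ... | refl = TAdj-child c (adj-refl (F x) (v , r) (v' , r')
                 (subst (TAdj _) (F·-cong (firstLevel-≡ A refl) v' r' r') (TAdj-unchild a)))
    where
    x : FirstLevel A
    x = at c v r

  glue : Iso (SubG A) (SubG B)
  glue = record
    { to = glueTo ; from = glueFrom ; from-to = glueFrom-glueTo ; to-from = glueTo-glueFrom
    ; root-pres = refl ; adj-pres = glueTo-adjacent ; adj-refl = glueTo-reflects }


_≈Iso_ : ∀ {G H} → Iso G H → Iso G H → Set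
φ ≈Iso ψ = ∀ x → to φ x ≡ to ψ x

module AutomorphismDecomposition {d m : ℕ} (A : Subtree d (suc m))
  (Q : ∀ x y → Iso (SubG (branch A x)) (SubG (branch A y)) → Set) where

  BranchIso : FirstLevel A → FirstLevel A → Set
  BranchIso x y = Σ (Iso (SubG (branch A x)) (SubG (branch A y))) (Q x y)

  BranchIsoEq : ∀ x y y' → BranchIso x y → BranchIso x y' → Set
  BranchIsoEq x y y' f g = ∀ v → proj₁ (to (proj₁ f) v) ≡ proj₁ (to (proj₁ g) v)

  glueFilling : Filling (FirstLevel A) BranchIso → Iso (SubG A) (SubG A)
  glueFilling (π , F) = Glue.glue A A π (proj₁ ∘ F)

  glue-cong : ∀ {a b} → FillingEq BranchIsoEq a b → glueFilling a ≈Iso glueFilling b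
  glue-cong (π≈ , F≈) (root , r) = refl
  glue-cong (π≈ , F≈) (child c v , r) = vertex-≡ A (cong₂ child (cong proj₁ (π≈ _)) (F≈ _ (v , r)))

  glue-reflects : ∀ {a b} → glueFilling a ≈Iso glueFilling b → FillingEq BranchIsoEq a b
  glue-reflects {π , F} {π' , F'} a≈b = π≈ , F≈
    where
    module G = Glue A A π (proj₁ ∘ F)
    module G' = Glue A A π' (proj₁ ∘ F')
    same-child : ∀ x v r → child (proj₁ (↔.to π x)) (G.F· x v r) ≡ child (proj₁ (↔.to π' x)) (G'.F· x v r)
    same-child x v r = trans (sym (G.glueTo-child x v r)) (trans (cong proj₁ (a≈b (child (proj₁ x) v , r))) (G'.glueTo-child x v r))
    π≈ : ∀ x → ↔.to π x ≡ ↔.to π' x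
    π≈ (c , p) = firstLevel-≡ A (child-injectiveˡ (same-child (c , p) root p))
    F≈ : ∀ x v → proj₁ (to (proj₁ (F x)) v) ≡ proj₁ (to (proj₁ (F' x)) v)
    F≈ x (v , r) = child-injectiveʳ (same-child x v r)

  glue-decomposition : ∀ φ (π : FirstLevel A ↔ FirstLevel A) (F : ∀ x → Iso (SubG (branch A x)) (SubG (branch A (↔.to π x)))) →
    (∀ x → ↔.to π x ≡ Branches.firstLevelTo A A φ x) →
    (∀ x v → proj₁ (to (F x) v) ≡ proj₁ (to (Branches.branchIso A A φ x) v)) →
    Glue.glue A A π F ≈Iso φ
  glue-decomposition φ π F π≈ F≈ (root , r) = vertex-≡ A (sym (Branches.φ·-root A A φ r))
  glue-decomposition φ π F π≈ F≈ (child c v , r) = vertex-≡ A (begin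
    child (proj₁ (↔.to π x)) (proj₁ (to (F x) (v , r)))                     ≡⟨ cong₂ child (cong proj₁ (π≈ x)) (F≈ x (v , r)) ⟩
    child (Branches.head A A φ x) (proj₁ (to (Branches.branchIso A A φ x) (v , r))) ≡⟨ Branches.decompose-spec A A φ x v r ⟨
    proj₁ (to φ (child c v , r))                                            ∎)
    where
    open ≡-Reasoning
    x : FirstLevel A
    x = (c , branch-root∈ A c v r)

  Card-decomposition : (P : Iso (SubG A) (SubG A) → Set) →
    (∀ π F → (∀ x → Q x (↔.to π x) (F x)) → P (Glue.glue A A π F)) →
    (∀ π F → P (Glue.glue A A π F) → ∀ x → Q x (↔.to π x) (F x)) →
    (∀ φ ψ → φ ≈Iso ψ → P φ → P ψ) →
    ∀ {n} → Card (Filling (FirstLevel A) BranchIso) (FillingEq BranchIsoEq) n →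
    Card (Σ (Iso (SubG A) (SubG A)) P) (λ a b → proj₁ a ≈Iso proj₁ b) n
  Card-decomposition P Q⇒P P⇒Q P-resp C =
    Card-bijection C (λ a → glueFilling a , Q⇒P (proj₁ a) (proj₁ ∘ proj₂ a) (proj₂ ∘ proj₂ a)) decompose
      (λ {a} {b} → glue-cong {a} {b}) (λ {a} {b} → glue-reflects {a} {b})
      (λ { {π , F} {φ , _} (π≈ , F≈) → glue-decomposition φ π (proj₁ ∘ F) π≈ F≈ })
    where
    decompose : Σ (Iso (SubG A) (SubG A)) P → Filling (FirstLevel A) BranchIso
    decompose (φ , p) = π , λ x → F x , P⇒Q π F (P-resp φ _ (λ v → sym (glue-decomposition φ π F (λ _ → refl) (λ _ _ → refl) v)) p) x
      where
      π : FirstLevel A ↔ FirstLevel A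
      π = Branches.firstLevel↔ A A φ
      F : ∀ x → Iso (SubG (branch A x)) (SubG (branch A (↔.to π x)))
      F = Branches.branchIso A A φ

module _ {d : ℕ} where
  open CountingBool using () renaming (count to countᵇ)

  Card-trues : (S : Fin d → Bool) → Card (Σ (Fin d) (T ∘ S)) (λ x y → proj₁ x ≡ proj₁ y) (countᵇ S true)
  Card-trues S = Card-bijection (CountingBool.Card-fibre S true) (λ (c , e) → c , Equivalence.from T-≡ e)
    (λ (c , p) → c , Equivalence.to T-≡ p) (λ e → e) (λ e → e) (λ e → e)

  ↔⇒same-counts : (S S' : Fin d → Bool) → Σ (Fin d) (T ∘ S) ↔ Σ (Fin d) (T ∘ S') → ∀ b → countᵇ S b ≡ countᵇ S' b
  ↔⇒same-counts S S' π = same-counts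
    where
    same-size : countᵇ S true ≡ countᵇ S' true
    same-size = Card-unique sym trans
      (Card-bijection (Card-trues S) (↔.to π) (↔.from π)
        (λ e → cong proj₁ (cong (↔.to π) (Σ-T-≡ e)))
        (λ e → cong proj₁ (Injection.injective (↔⇒↣ π) (Σ-T-≡ e)))
        (λ {_} {b} e → cong proj₁ (trans (cong (↔.to π) (Σ-T-≡ e)) (↔.strictlyInverseˡ π b))))
      (Card-trues S')
    same-counts : ∀ b → countᵇ S b ≡ countᵇ S' b
    same-counts true = same-size
    same-counts false = +-cancelʳ-≡ (countᵇ S' true) _ _
      (trans (cong (countᵇ S false +_) (sym same-size)) (trans (count-false+true S) (sym (count-false+true S'))))

  Extends : (S S' : Fin d → Bool) → Σ (Fin d) (T ∘ S) ↔ Σ (Fin d) (T ∘ S') → Permutation′ d → Set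
  Extends S S' π τ = (∀ x → τ ⟨$⟩ʳ proj₁ x ≡ proj₁ (↔.to π x)) × (∀ c → S c ≡ S' (τ ⟨$⟩ʳ c))

  extendToPermutation : (S S' : Fin d → Bool) (π : Σ (Fin d) (T ∘ S) ↔ Σ (Fin d) (T ∘ S')) → Σ (Permutation′ d) (Extends S S' π)
  extendToPermutation S S' π = permutation forth back forth-back back-forth , forth-in , S-forth
    where
    ρ : Permutation′ d
    ρ = proj₁ (CountingBool.aligningPermutation S S' (↔⇒same-counts S S' π))
    ρ-aligns : ∀ c → S c ≡ S' (ρ ⟨$⟩ʳ c)
    ρ-aligns = proj₂ (CountingBool.aligningPermutation S S' (↔⇒same-counts S S' π))
    T-≡true : ∀ {b} → T b → b ≡ true
    T-≡true = Equivalence.to T-≡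
    forth : Fin d → Fin d
    forth c with T? (S c)
    ... | yes p = proj₁ (↔.to π (c , p))
    ... | no _ = ρ ⟨$⟩ʳ c
    back : Fin d → Fin d
    back c' with T? (S' c')
    ... | yes q = proj₁ (↔.from π (c' , q))
    ... | no _ = ρ ⟨$⟩ˡ c'
    forth-in : ∀ x → forth (proj₁ x) ≡ proj₁ (↔.to π x)
    forth-in (c , p) with T? (S c)
    ... | yes p' = cong (λ z → proj₁ (↔.to π (c , z))) (T-irrelevant p' p)
    ... | no ¬p = ⊥-elim (¬p p)
    back-in : ∀ y → back (proj₁ y) ≡ proj₁ (↔.from π y)
    back-in (c' , q) with T? (S' c')
    ... | yes q' = cong (λ z → proj₁ (↔.from π (c' , z))) (T-irrelevant q' q)
    ... | no ¬q = ⊥-elim (¬q q)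
    back-out : ∀ c' → ¬ T (S' c') → back c' ≡ ρ ⟨$⟩ˡ c'
    back-out c' ¬q with T? (S' c')
    ... | yes q = ⊥-elim (¬q q)
    ... | no _ = refl
    forth-out : ∀ c → ¬ T (S c) → forth c ≡ ρ ⟨$⟩ʳ c
    forth-out c ¬p with T? (S c)
    ... | yes p = ⊥-elim (¬p p)
    ... | no _ = refl
    back-forth : ∀ c → back (forth c) ≡ c
    back-forth c with T? (S c)
    ... | yes p = trans (back-in (↔.to π (c , p))) (cong proj₁ (↔.strictlyInverseʳ π (c , p)))
    ... | no ¬p = trans (back-out _ (¬p ∘ subst T (sym (ρ-aligns c)))) (inverseˡ ρ)
    forth-back : ∀ c' → forth (back c') ≡ c'
    forth-back c' with T? (S' c')
    ... | yes q = trans (forth-in (↔.from π (c' , q))) (cong proj₁ (↔.strictlyInverseˡ π (c' , q)))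
    ... | no ¬q = trans (forth-out _ (¬q ∘ subst T (trans (ρ-aligns _) (cong S' (inverseʳ ρ))))) (inverseʳ ρ)
    S-forth : ∀ c → S c ≡ S' (forth c)
    S-forth c with T? (S c)
    ... | yes p = trans (T-≡true p) (sym (T-≡true (proj₂ (↔.to π (c , p)))))
    ... | no _ = ρ-aligns c

full : ∀ d m → Subtree d m
full d m = record { mem = λ _ → true ; root∈ = tt ; closed = λ _ _ → tt }

toFull : ∀ {d m} → Aut (TreeG d m) → Aut (SubG (full d m))
toFull g = record
  { to = λ x → to g (proj₁ x) , tt ; from = λ x → from g (proj₁ x) , tt
  ; from-to = λ x → cong (_, tt) (from-to g (proj₁ x)) ; to-from = λ x → cong (_, tt) (to-from g (proj₁ x))
  ; root-pres = cong (_, tt) (root-pres g)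
  ; adj-pres = λ x y → adj-pres g (proj₁ x) (proj₁ y) ; adj-refl = λ x y → adj-refl g (proj₁ x) (proj₁ y) }

fromFull : ∀ {d m} → Aut (SubG (full d m)) → Aut (TreeG d m)
fromFull g = record
  { to = λ v → proj₁ (to g (v , tt)) ; from = λ v → proj₁ (from g (v , tt))
  ; from-to = λ v → cong proj₁ (from-to g (v , tt)) ; to-from = λ v → cong proj₁ (to-from g (v , tt))
  ; root-pres = cong proj₁ (root-pres g)
  ; adj-pres = λ v w → adj-pres g (v , tt) (w , tt) ; adj-refl = λ v w → adj-refl g (v , tt) (w , tt) }

Carries : ∀ {d m} → (Vtx d m → Bool) → (Vtx d m → Bool) → (Vtx d m → Vtx d m) → Set
Carries P Q f = ∀ v → (T (P v) → T (Q (f v))) × (T (Q (f v)) → T (P v))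

Fixes : ∀ {d m} → (Vtx d m → Bool) → (Vtx d m → Vtx d m) → Set
Fixes P f = ∀ v → T (P v) → f v ≡ v

firstLevel-full : ∀ {d m} → Fin d ↔ FirstLevel (full d (suc m))
firstLevel-full = mk↔ₛ′ (_, tt) proj₁ (λ _ → refl) (λ _ → refl)

Card-toFull : ∀ {d m} (Q : (Vtx d m → Vtx d m) → Set) {n} →
  Card (Σ (Aut (TreeG d m)) (Q ∘ to)) (λ a b → proj₁ a ≈Iso proj₁ b) n →
  Card (Σ (Aut (SubG (full d m))) (Q ∘ to ∘ fromFull)) (λ a b → ∀ v → proj₁ (to (proj₁ a) v) ≡ proj₁ (to (proj₁ b) v)) n
Card-toFull Q C = Card-bijection C (λ (g , q) → toFull g , q) (λ (f , q) → fromFull f , q)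
  (λ e v → e (proj₁ v)) (λ e v → e (v , tt)) (λ e v → e (proj₁ v))

Card-fromFull : ∀ {d m} (P : (Vtx d m → Vtx d m) → Set) {n} →
  Card (Σ (Aut (SubG (full d m))) (P ∘ to ∘ fromFull)) (λ a b → proj₁ a ≈Iso proj₁ b) n →
  Card (Σ (Aut (TreeG d m)) (P ∘ to)) (λ a b → proj₁ a ≈Iso proj₁ b) n
Card-fromFull P C = Card-bijection C (λ (f , p) → fromFull f , p) (λ (g , p) → toFull g , p)
  (λ e v → cong proj₁ (e (v , tt))) (λ e v → cong (_, tt) (e (proj₁ v))) (λ e v → cong proj₁ (e (v , tt)))

Carries-trans : ∀ {d m} {P Q R : Vtx d m → Bool} {g h : Aut (TreeG d m)} → Carries P Q (to g) → Carries Q R (to h) → Carries P R (to (Iso-trans g h))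
Carries-trans {g = g} g-PQ h-QR v = proj₁ (h-QR (to g v)) ∘ proj₁ (g-PQ v) , proj₂ (g-PQ v) ∘ proj₂ (h-QR (to g v))

Carries-sym : ∀ {d m} {P Q : Vtx d m → Bool} {g : Aut (TreeG d m)} → Carries P Q (to g) → Carries Q P (from g)
Carries-sym {Q = Q} {g} g-PQ v =
  (λ q → proj₂ (g-PQ (from g v)) (subst (T ∘ Q) (sym (to-from g v)) q)) ,
  (λ p → subst (T ∘ Q) (to-from g v) (proj₁ (g-PQ (from g v)) p))

Carries-conjugate : ∀ {d m} {P P' Q Q' : Vtx d m → Bool} (φ ψ : Aut (TreeG d m)) →
  Carries P' P (to φ) → Carries Q' Q (to ψ) → ∀ g → Carries P Q (to g) → Carries P' Q' (to (Iso-trans φ (Iso-trans g (Iso-sym ψ))))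
Carries-conjugate {P = P} {P'} {Q} {Q'} φ ψ φ-carries ψ-carries g g-carries =
  Carries-trans {P = P'} {Q = P} {R = Q'} {g = φ} {h = Iso-trans g (Iso-sym ψ)} φ-carries
    (Carries-trans {P = P} {Q = Q} {R = Q'} {g = g} {h = Iso-sym ψ} g-carries (Carries-sym {P = Q'} {Q = Q} {g = ψ} ψ-carries))

restrict : ∀ {d m} (A B : Subtree d m) (g : Aut (TreeG d m)) → Carries (mem A) (mem B) (to g) → Iso (SubG A) (SubG B)
restrict A B g g-AB = record
  { to = λ x → to g (proj₁ x) , proj₁ (g-AB (proj₁ x)) (proj₂ x)
  ; from = λ y → from g (proj₁ y) , proj₂ (g-AB (from g (proj₁ y))) (subst (T ∘ mem B) (sym (to-from g (proj₁ y))) (proj₂ y))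
  ; from-to = λ x → vertex-≡ A (from-to g (proj₁ x)) ; to-from = λ y → vertex-≡ B (to-from g (proj₁ y))
  ; root-pres = vertex-≡ B (root-pres g)
  ; adj-pres = λ x y → adj-pres g (proj₁ x) (proj₁ y) ; adj-refl = λ x y → adj-refl g (proj₁ x) (proj₁ y) }

graft : ∀ {d m} → Permutation′ d → (Fin d → Aut (TreeG d m)) → Aut (TreeG d (suc m))
graft {d} {m} τ g = fromFull (Glue.glue (full d (suc m)) (full d (suc m)) τ′ (toFull ∘ g ∘ proj₁))
  where
  τ′ : FirstLevel (full d (suc m)) ↔ FirstLevel (full d (suc m))
  τ′ = mk↔ₛ′ (λ (c , _) → τ ⟨$⟩ʳ c , tt) (λ (c , _) → τ ⟨$⟩ˡ c , tt) (λ _ → cong (_, tt) (inverseʳ τ)) (λ _ → cong (_, tt) (inverseˡ τ))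

extension : ∀ {d} m (A B : Subtree d m) → Iso (SubG A) (SubG B) → Σ (Aut (TreeG d m)) (Carries (mem A) (mem B) ∘ to)
extension zero A B φ = Iso-refl , λ { root → (λ _ → root∈ B) , (λ _ → root∈ A) }
extension {d} (suc m) A B φ = graft τ branchAut , carries
  where
  open Branches A B φ using (firstLevel↔; branchIso)
  extended : Σ (Permutation′ d) (Extends (λ c → mem A (child c root)) (λ c → mem B (child c root)) firstLevel↔)
  extended = extendToPermutation _ _ firstLevel↔
  τ : Permutation′ d
  τ = proj₁ extended
  τ-in : ∀ x → τ ⟨$⟩ʳ proj₁ x ≡ proj₁ (↔.to firstLevel↔ x)
  τ-in = proj₁ (proj₂ extended)
  τ-outside : ∀ c → mem A (child c root) ≡ mem B (child (τ ⟨$⟩ʳ c) root)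
  τ-outside = proj₂ (proj₂ extended)
  branchExtension : ∀ c p → Σ (Aut (TreeG d m)) (Carries (mem A ∘ child c) (mem B ∘ child (τ ⟨$⟩ʳ c)) ∘ to)
  branchExtension c p with extension m (branch A (c , p)) (branch B (↔.to firstLevel↔ (c , p))) (branchIso (c , p))
  ... | h , h-carries = h , subst (λ c' → Carries (mem A ∘ child c) (mem B ∘ child c') (to h)) (sym (τ-in (c , p))) h-carries
  extendBranch : ∀ c → Dec (T (mem A (child c root))) → Aut (TreeG d m)
  extendBranch c (yes p) = proj₁ (branchExtension c p)
  extendBranch c (no _) = Iso-refl
  branchAut : Fin d → Aut (TreeG d m)
  branchAut c = extendBranch c (T? (mem A (child c root)))
  carries-branch : ∀ c p? → Carries (mem A ∘ child c) (mem B ∘ child (τ ⟨$⟩ʳ c)) (to (extendBranch c p?))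
  carries-branch c (yes p) = proj₂ (branchExtension c p)
  carries-branch c (no ¬p) w =
    ⊥-elim ∘ ¬p ∘ branch-root∈ A c w ,
    ⊥-elim ∘ ¬p ∘ subst T (sym (τ-outside c)) ∘ branch-root∈ B (τ ⟨$⟩ʳ c) w
  carries : Carries (mem A) (mem B) (to (graft τ branchAut))
  carries root = (λ _ → root∈ B) , (λ _ → root∈ A)
  carries (child c w) = carries-branch c (T? (mem A (child c root))) w

Card-conjugate : ∀ {G H G' H'} (φ : Iso G' G) (ψ : Iso H' H) (P : Iso G H → Set) (P' : Iso G' H' → Set) →
  (∀ g → P g → P' (Iso-trans φ (Iso-trans g (Iso-sym ψ)))) → (∀ h → P' h → P (Iso-trans (Iso-sym φ) (Iso-trans h ψ))) →
  ∀ {n} → Card (Σ (Iso G H) P) (λ a b → proj₁ a ≈Iso proj₁ b) n → Card (Σ (Iso G' H') P') (λ a b → proj₁ a ≈Iso proj₁ b) n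
Card-conjugate φ ψ P P' P⇒P' P'⇒P C = Card-bijection C
  (λ (g , p) → Iso-trans φ (Iso-trans g (Iso-sym ψ)) , P⇒P' g p)
  (λ (h , p) → Iso-trans (Iso-sym φ) (Iso-trans h ψ) , P'⇒P h p)
  (λ g≈g' v → cong (from ψ) (g≈g' (to φ v)))
  (λ { {g , _} {g' , _} e w → begin
       to g w                                 ≡⟨ cong (to g) (to-from φ w) ⟨
       to g (to φ (from φ w))                 ≡⟨ to-from ψ _ ⟨
       to ψ (from ψ (to g (to φ (from φ w)))) ≡⟨ cong (to ψ) (e (from φ w)) ⟩
       to ψ (from ψ (to g' (to φ (from φ w)))) ≡⟨ to-from ψ _ ⟩
       to g' (to φ (from φ w))                ≡⟨ cong (to g') (to-from φ w) ⟩
       to g' w                                ∎ })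
  (λ { {g , _} {h , _} e v → trans (cong (from ψ) (e (to φ v))) (trans (from-to ψ _) (cong (to h) (from-to φ v))) })
  where open ≡-Reasoning

module Counts (d k : ℕ) (Γ : Subtree d (suc k)) (l : ℕ) (rootDeg : RootDeg Γ l)
  (i : ℕ) (Γs : Fin i → Subtree d k) (α : Fin i → ℕ) (type : IsTypeOf Γ Γs α) where
  open IsTypeOf type

  typeOf : FirstLevel Γ → Fin i
  typeOf x = proj₁ (covers x)

  typeIso : ∀ x → Iso (SubG (branch Γ x)) (SubG (Γs (typeOf x)))
  typeIso x = proj₂ (covers x)

  typeOf-unique : ∀ x j → Iso (SubG (branch Γ x)) (SubG (Γs j)) → typeOf x ≡ j
  typeOf-unique x j φ = pairwise-noniso _ _ (Iso-trans (Iso-sym (typeIso x)) φ)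

  typeIso′ : ∀ x {j} → typeOf x ≡ j → Iso (SubG (branch Γ x)) (SubG (Γs j))
  typeIso′ x refl = typeIso x

  Card-ofType : ∀ j → Card (Σ (FirstLevel Γ) (λ x → typeOf x ≡ j)) (λ x y → proj₁ (proj₁ x) ≡ proj₁ (proj₁ y)) (α j)
  Card-ofType j = Card-bijection (multiplicity j) (λ (x , φ) → x , typeOf-unique x j φ) (λ (x , e) → x , typeIso′ x e)
    (λ e → e) (λ e → e) (λ e → e)

  module Automorphisms (a : Fin i → ℕ) (Aut-Γs : ∀ j → CardAut (SubG (Γs j)) (a j)) where
    open AutomorphismDecomposition Γ (λ _ _ _ → ⊤)

    Card-BranchIso : ∀ x y → typeOf x ≡ typeOf y → Card (BranchIso x y) (BranchIsoEq x y y) (a (typeOf x))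
    Card-BranchIso x y same = Card-bijection
      (Card-conjugate (typeIso x) (typeIso′ y (sym same)) (λ _ → ⊤) (λ _ → ⊤) _ _
        (Card-bijection (Aut-Γs (typeOf x)) (_, tt) proj₁ (λ e → e) (λ e → e) (λ e → e)))
      (λ f → f) (λ f → f) (λ e v → cong proj₁ (e v)) (λ e v → vertex-≡ (branch Γ y) (e v)) (λ e v → cong proj₁ (e v))

    ¬BranchIso : ∀ x y → typeOf x ≢ typeOf y → ¬ BranchIso x y
    ¬BranchIso x y different (φ , _) = different (typeOf-unique x (typeOf y) (Iso-trans φ (typeIso y)))

    enumerate : Fin l ↔ FirstLevel Γ
    enumerate = Card-↔ (firstLevel-≡ Γ) rootDeg

    class : Fin l → Fin i
    class p = typeOf (↔.to enumerate p)

    count-class : ∀ j → count class j ≡ α j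
    count-class j = Card-unique sym trans (Card-fibre class j)
      (Card-bijection (Card-ofType j) (λ (x , e) → ↔.from enumerate x , subst (λ z → typeOf z ≡ j) (sym (↔.strictlyInverseˡ enumerate x)) e)
        (λ (p , e) → ↔.to enumerate p , e)
        (λ e → cong (↔.from enumerate) (firstLevel-≡ Γ e))
        (λ e → cong proj₁ (Injection.injective (↔⇒↣ (↔-sym enumerate)) e))
        (λ {_} {(p , _)} e → trans (cong (↔.from enumerate) (firstLevel-≡ Γ e)) (↔.strictlyInverseʳ enumerate p)))

    Card-fillings : Card (Filling (FirstLevel Γ) BranchIso) (FillingEq BranchIsoEq) (product (λ j → count class j ! * a j ^ count class j))
    Card-fillings = Card-relabel enumerate BranchIso BranchIsoEq
      (Card-Filling class class (λ p q → BranchIso (↔.to enumerate p) (↔.to enumerate q))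
        (λ p q q' → BranchIsoEq (↔.to enumerate p) (↔.to enumerate q) (↔.to enumerate q')) a (λ _ → refl)
        (λ p q → Card-BranchIso (↔.to enumerate p) (↔.to enumerate q))
        (λ p q → ¬BranchIso (↔.to enumerate p) (↔.to enumerate q)))

    Card-Aut : CardAut (SubG Γ) (prodFin (λ j → α j ! * a j ^ α j))
    Card-Aut = subst (CardAut (SubG Γ)) size-eq
      (Card-bijection (Card-decomposition (λ _ → ⊤) _ _ _ Card-fillings) proj₁ (_, tt) (λ e → e) (λ e → e) (λ e → e))
      where
      size-eq : product (λ j → count class j ! * a j ^ count class j) ≡ prodFin (λ j → α j ! * a j ^ α j)
      size-eq = trans (product-cong λ j → cong (λ n → n ! * a j ^ n) (count-class j)) (sym (prodFin≡product (λ j → α j ! * a j ^ α j)))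

  Inside : Fin d → Bool
  Inside c = mem Γ (child c root)

  branchMem : Fin d → Vtx d k → Bool
  branchMem c v = mem Γ (child c v)

  outside-branch : ∀ c → ¬ T (Inside c) → ∀ v → ¬ T (branchMem c v)
  outside-branch c ¬p v = ¬p ∘ branch-root∈ Γ c v

  count-outside : ∀ {N} (cl : Fin d → Fin (suc N)) → (∀ c → cl c ≡ zero → ¬ T (Inside c)) → (∀ c → ¬ T (Inside c) → cl c ≡ zero) →
    count cl zero ≡ d ∸ l
  count-outside cl zero⇒outside outside⇒zero = begin
    count cl zero                                                   ≡⟨ count-zero≡count-false ⟩
    countᵇ Inside false                                             ≡⟨ m+n∸n≡m _ (countᵇ Inside true) ⟨
    countᵇ Inside false + countᵇ Inside true ∸ countᵇ Inside true   ≡⟨ cong₂ _∸_ (count-false+true Inside) (sym l≡) ⟩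
    d ∸ l                                                           ∎
    where
    open ≡-Reasoning
    open CountingBool using () renaming (count to countᵇ)
    l≡ : l ≡ countᵇ Inside true
    l≡ = Card-unique sym trans rootDeg (Card-trues Inside)
    ¬T⇒false : ∀ {b} → ¬ T b → b ≡ false
    ¬T⇒false {false} _ = refl
    ¬T⇒false {true} ¬t = ⊥-elim (¬t tt)
    count-zero≡count-false : count cl zero ≡ countᵇ Inside false
    count-zero≡count-false = Card-unique sym trans (Card-fibre cl zero)
      (Card-bijection (CountingBool.Card-fibre Inside false)
        (λ (c , e) → c , outside⇒zero c (λ p → subst T e p)) (λ (c , e) → c , ¬T⇒false (zero⇒outside c e))
        (λ e → e) (λ e → e) (λ e → e))

  classify : ∀ c → Dec (T (Inside c)) → Fin (suc i)
  classify c (yes p) = suc (typeOf (c , p))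
  classify c (no _) = zero

  classOf : Fin d → Fin (suc i)
  classOf c = classify c (T? (Inside c))

  classOf-inside : ∀ c p → classOf c ≡ suc (typeOf (c , p))
  classOf-inside c p = classify-inside (T? (Inside c))
    where
    classify-inside : ∀ p? → classify c p? ≡ suc (typeOf (c , p))
    classify-inside (yes p') = cong (λ z → suc (typeOf (c , z))) (T-irrelevant p' p)
    classify-inside (no ¬p) = ⊥-elim (¬p p)

  classOf-outside : ∀ c → ¬ T (Inside c) → classOf c ≡ zero
  classOf-outside c ¬p = classify-outside (T? (Inside c))
    where
    classify-outside : ∀ p? → classify c p? ≡ zero
    classify-outside (yes p) = ⊥-elim (¬p p)
    classify-outside (no _) = refl

  classOf-suc : ∀ c {j} → classOf c ≡ suc j → Σ (T (Inside c)) (λ p → typeOf (c , p) ≡ j)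
  classOf-suc c = classify-suc (T? (Inside c))
    where
    classify-suc : ∀ p? {j} → classify c p? ≡ suc j → Σ (T (Inside c)) (λ p → typeOf (c , p) ≡ j)
    classify-suc (yes p) e = p , Fin-suc-injective e

  count-classOf-zero : count classOf zero ≡ d ∸ l
  count-classOf-zero = count-outside classOf (λ c e p → 0≢1+n (trans (sym e) (classOf-inside c p))) classOf-outside

  count-classOf-suc : ∀ j → count classOf (suc j) ≡ α j
  count-classOf-suc j = Card-unique sym trans (Card-fibre classOf (suc j))
    (Card-bijection (Card-ofType j) (λ ((c , p) , e) → c , trans (classOf-inside c p) (cong suc e))
      (λ (c , e) → (c , proj₁ (classOf-suc c e)) , proj₂ (classOf-suc c e)) (λ e → e) (λ e → e) (λ e → e))

  Full : Subtree d (suc k)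
  Full = full d (suc k)

  module Stabilizer (t : ℕ) (s : Fin i → ℕ) (Aut-T : CardAut (TreeG d k) t) (St-Γs : ∀ j → CardSt (Γs j) (s j)) where

    CarriesBranch : Fin d → Fin d → (Vtx d k → Vtx d k) → Set
    CarriesBranch c c' = Carries (branchMem c) (branchMem c')

    open AutomorphismDecomposition Full (λ x y f → CarriesBranch (proj₁ x) (proj₁ y) (to (fromFull f)))

    size : Fin (suc i) → ℕ
    size zero = t
    size (suc j) = s j

    Card-carrying : ∀ c c' → classOf c ≡ classOf c' →
      Card (Σ (Aut (TreeG d k)) (CarriesBranch c c' ∘ to)) (λ a b → proj₁ a ≈Iso proj₁ b) (size (classOf c))
    Card-carrying c c' = by-inside (T? (Inside c)) (T? (Inside c'))
      where
      by-inside : ∀ p? q? → classify c p? ≡ classify c' q? →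
        Card (Σ (Aut (TreeG d k)) (CarriesBranch c c' ∘ to)) (λ a b → proj₁ a ≈Iso proj₁ b) (size (classify c p?))
      by-inside (no ¬p) (no ¬q) _ = Card-bijection Aut-T (λ g → g , vacuous) proj₁ (λ e → e) (λ e → e) (λ e → e)
        where
        vacuous : ∀ {f} → CarriesBranch c c' f
        vacuous v = ⊥-elim ∘ outside-branch c ¬p v , ⊥-elim ∘ outside-branch c' ¬q _
      by-inside (yes p) (yes q) same = Card-conjugate (Iso-sym (proj₁ hx)) (Iso-sym (proj₁ hy))
        (Carries (mem (Γs j)) (mem (Γs j)) ∘ to) (CarriesBranch c c' ∘ to)
        (Carries-conjugate {P = mem (Γs j)} {branchMem c} {mem (Γs j)} {branchMem c'} (Iso-sym (proj₁ hx)) (Iso-sym (proj₁ hy))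
           (Carries-sym {P = mem (Γs j)} {branchMem c} {g = proj₁ hx} (proj₂ hx))
           (Carries-sym {P = mem (Γs j)} {branchMem c'} {g = proj₁ hy} (proj₂ hy)))
        (Carries-conjugate {P = branchMem c} {mem (Γs j)} {branchMem c'} {mem (Γs j)} (proj₁ hx) (proj₁ hy) (proj₂ hx) (proj₂ hy))
        (St-Γs j)
        where
        j : Fin i
        j = typeOf (c , p)
        hx : Σ (Aut (TreeG d k)) (Carries (mem (Γs j)) (branchMem c) ∘ to)
        hx = extension k (Γs j) (branch Γ (c , p)) (Iso-sym (typeIso (c , p)))
        hy : Σ (Aut (TreeG d k)) (Carries (mem (Γs j)) (branchMem c') ∘ to)
        hy = extension k (Γs j) (branch Γ (c' , q)) (Iso-sym (typeIso′ (c' , q) (sym (Fin-suc-injective same))))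
      by-inside (yes _) (no _) ()
      by-inside (no _) (yes _) ()

    ¬carrying : ∀ c c' → classOf c ≢ classOf c' → (g : Aut (TreeG d k)) → ¬ CarriesBranch c c' (to g)
    ¬carrying c c' = by-inside (T? (Inside c)) (T? (Inside c'))
      where
      by-inside : ∀ p? q? → classify c p? ≢ classify c' q? → (g : Aut (TreeG d k)) → ¬ CarriesBranch c c' (to g)
      by-inside (no _) (no _) different _ _ = different refl
      by-inside (yes p) (no ¬q) _ g g-carries = ¬q (subst (T ∘ branchMem c') (root-pres g) (proj₁ (g-carries root) p))
      by-inside (no ¬p) (yes q) _ g g-carries = ¬p (proj₂ (g-carries root) (subst (T ∘ branchMem c') (sym (root-pres g)) q))
      by-inside (yes p) (yes q) different g g-carries = different (cong suc (typeOf-unique (c , p) (typeOf (c' , q))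
        (Iso-trans (restrict (branch Γ (c , p)) (branch Γ (c' , q)) g g-carries) (typeIso (c' , q)))))

    Card-fillings : Card (Filling (FirstLevel Full) BranchIso) (FillingEq BranchIsoEq)
                         (product (λ n → count classOf n ! * size n ^ count classOf n))
    Card-fillings = Card-relabel (firstLevel-full {d} {k}) BranchIso BranchIsoEq
      (Card-Filling classOf classOf (λ c c' → BranchIso (c , tt) (c' , tt)) (λ c c' c'' → BranchIsoEq (c , tt) (c' , tt) (c'' , tt))
        size (λ _ → refl)
        (λ c c' same → Card-toFull (CarriesBranch c c') (Card-carrying c c' same))
        (λ c c' different (g , g-carries) → ¬carrying c c' different (fromFull g) g-carries))

    Card-St : CardSt Γ ((d ∸ l) ! * t ^ (d ∸ l) * prodFin (λ j → α j ! * s j ^ α j))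
    Card-St = subst (CardSt Γ) size-eq (Card-fromFull (Carries (mem Γ) (mem Γ))
      (Card-decomposition (Carries (mem Γ) (mem Γ) ∘ to ∘ fromFull)
        (λ π F branches-carry → λ { root → (λ _ → root∈ Γ) , (λ _ → root∈ Γ) ; (child c w) → branches-carry (c , tt) w })
        (λ π F carries x w → carries (child (proj₁ x) w))
        (λ φ ψ φ≈ψ carries v → subst (λ u → T (mem Γ v) → T (mem Γ u)) (cong proj₁ (φ≈ψ (v , tt))) (proj₁ (carries v)) ,
                               proj₂ (carries v) ∘ subst (T ∘ mem Γ) (sym (cong proj₁ (φ≈ψ (v , tt)))))
        Card-fillings))
      where
      size-eq : product (λ n → count classOf n ! * size n ^ count classOf n) ≡ (d ∸ l) ! * t ^ (d ∸ l) * prodFin (λ j → α j ! * s j ^ α j)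
      size-eq = cong₂ _*_ (cong (λ n → n ! * t ^ n) count-classOf-zero)
        (trans (product-cong λ j → cong (λ n → n ! * s j ^ n) (count-classOf-suc j)) (sym (prodFin≡product (λ j → α j ! * s j ^ α j))))

  module Fixator (t : ℕ) (f : Fin i → ℕ) (Aut-T : CardAut (TreeG d k) t) (Fix-Γs : ∀ j → CardFix (Γs j) (f j)) where

    FixesBranch : Fin d → Fin d → (Vtx d k → Vtx d k) → Set
    FixesBranch c c' g = (T (Inside c) → c' ≡ c) × (T (Inside c') → T (Inside c)) × Fixes (branchMem c) g

    open AutomorphismDecomposition Full (λ x y φ → FixesBranch (proj₁ x) (proj₁ y) (to (fromFull φ)))

    fixClassify : ∀ c → Dec (T (Inside c)) → Fin (suc d)
    fixClassify c (yes _) = suc c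
    fixClassify c (no _) = zero

    fixClass : Fin d → Fin (suc d)
    fixClass c = fixClassify c (T? (Inside c))

    fixClass-inside : ∀ c → T (Inside c) → fixClass c ≡ suc c
    fixClass-inside c p = by-inside (T? (Inside c))
      where
      by-inside : ∀ p? → fixClassify c p? ≡ suc c
      by-inside (yes _) = refl
      by-inside (no ¬p) = ⊥-elim (¬p p)

    fixClass-outside : ∀ c → ¬ T (Inside c) → fixClass c ≡ zero
    fixClass-outside c ¬p = by-inside (T? (Inside c))
      where
      by-inside : ∀ p? → fixClassify c p? ≡ zero
      by-inside (yes p) = ⊥-elim (¬p p)
      by-inside (no _) = refl

    fixClass-suc : ∀ c' {c} → fixClass c' ≡ suc c → c' ≡ c × T (Inside c')
    fixClass-suc c' = by-inside (T? (Inside c'))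
      where
      by-inside : ∀ p? {c} → fixClassify c' p? ≡ suc c → c' ≡ c × T (Inside c')
      by-inside (yes p) e = Fin-suc-injective e , p

    branchFixSize : Fin (suc i) → ℕ
    branchFixSize zero = 1
    branchFixSize (suc j) = f j

    fixSize : Fin (suc d) → ℕ
    fixSize zero = t
    fixSize (suc c) = branchFixSize (classOf c)

    Card-fixing : ∀ c c' → fixClass c ≡ fixClass c' →
      Card (Σ (Aut (TreeG d k)) (FixesBranch c c' ∘ to)) (λ a b → proj₁ a ≈Iso proj₁ b) (fixSize (fixClass c))
    Card-fixing c c' = by-inside (T? (Inside c)) (T? (Inside c'))
      where
      by-inside : ∀ p? q? → fixClassify c p? ≡ fixClassify c' q? →
        Card (Σ (Aut (TreeG d k)) (FixesBranch c c' ∘ to)) (λ a b → proj₁ a ≈Iso proj₁ b) (fixSize (fixClassify c p?))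
      by-inside (no ¬p) (no ¬q) _ = Card-bijection Aut-T (λ g → g , vacuous) proj₁ (λ e → e) (λ e → e) (λ e → e)
        where
        vacuous : ∀ {g} → FixesBranch c c' g
        vacuous = ⊥-elim ∘ ¬p , ⊥-elim ∘ ¬q , λ v → ⊥-elim ∘ outside-branch c ¬p v
      by-inside (yes p) (yes _) refl = subst (Card _ _) (cong branchFixSize (sym (classOf-inside c p)))
        (Card-conjugate (Iso-sym (proj₁ hx)) (Iso-sym (proj₁ hx)) (Fixes (mem (Γs j)) ∘ to) (FixesBranch c c ∘ to)
          (λ g g-fixes → (λ _ → refl) , (λ r → r) , λ v r →
             trans (cong (to (proj₁ hx)) (g-fixes _ (proj₁ (Carries-sym {P = mem (Γs j)} {branchMem c} {g = proj₁ hx} (proj₂ hx) v) r)))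
                   (to-from (proj₁ hx) v))
          (λ h (_ , _ , h-fixes) v r →
             trans (cong (from (proj₁ hx)) (h-fixes _ (proj₁ (proj₂ hx v) r))) (from-to (proj₁ hx) v))
          (Fix-Γs j))
        where
        j : Fin i
        j = typeOf (c , p)
        hx : Σ (Aut (TreeG d k)) (Carries (mem (Γs j)) (branchMem c) ∘ to)
        hx = extension k (Γs j) (branch Γ (c , p)) (Iso-sym (typeIso (c , p)))
      by-inside (yes _) (no _) ()
      by-inside (no _) (yes _) ()

    ¬fixing : ∀ c c' → fixClass c ≢ fixClass c' → (g : Aut (TreeG d k)) → ¬ FixesBranch c c' (to g)
    ¬fixing c c' different g (c'≡c , inside-c' , _) = by-inside (T? (Inside c)) (T? (Inside c'))
      where
      by-inside : Dec (T (Inside c)) → Dec (T (Inside c')) → ⊥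
      by-inside (yes p) _ = different (cong fixClass (sym (c'≡c p)))
      by-inside (no ¬p) (yes q) = ¬p (inside-c' q)
      by-inside (no ¬p) (no ¬q) = different (trans (fixClass-outside c ¬p) (sym (fixClass-outside c' ¬q)))

    count-fixClass-zero : count fixClass zero ≡ d ∸ l
    count-fixClass-zero = count-outside fixClass (λ c e p → 0≢1+n (trans (sym e) (fixClass-inside c p))) fixClass-outside

    fixFactor : ∀ c → count fixClass (suc c) ! * fixSize (suc c) ^ count fixClass (suc c) ≡ branchFixSize (classOf c)
    fixFactor c = by-inside (T? (Inside c))
      where
      by-inside : Dec (T (Inside c)) → count fixClass (suc c) ! * fixSize (suc c) ^ count fixClass (suc c) ≡ branchFixSize (classOf c)
      by-inside (yes p) = trans (cong (λ n → n ! * fixSize (suc c) ^ n) count≡1) (trans (+-identityʳ _) (*-identityʳ _))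
        where
        count≡1 : count fixClass (suc c) ≡ 1
        count≡1 = Card-unique sym trans (Card-fibre fixClass (suc c))
          (Card-singleton (c , fixClass-inside c p) (λ (c' , e) → sym (proj₁ (fixClass-suc c' e))))
      by-inside (no ¬p) = trans (cong (λ n → n ! * fixSize (suc c) ^ n) count≡0) (cong branchFixSize (sym (classOf-outside c ¬p)))
        where
        count≡0 : count fixClass (suc c) ≡ 0
        count≡0 = Card-unique sym trans (Card-fibre fixClass (suc c))
          (Card-empty λ (c' , e) → ¬p (subst (T ∘ Inside) (proj₁ (fixClass-suc c' e)) (proj₂ (fixClass-suc c' e))))

    Card-fillings : Card (Filling (FirstLevel Full) BranchIso) (FillingEq BranchIsoEq)
                         (product (λ n → count fixClass n ! * fixSize n ^ count fixClass n))
    Card-fillings = Card-relabel (firstLevel-full {d} {k}) BranchIso BranchIsoEq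
      (Card-Filling fixClass fixClass (λ c c' → BranchIso (c , tt) (c' , tt)) (λ c c' c'' → BranchIsoEq (c , tt) (c' , tt) (c'' , tt))
        fixSize (λ _ → refl)
        (λ c c' same → Card-toFull (FixesBranch c c') (Card-fixing c c' same))
        (λ c c' different (g , g-fixes) → ¬fixing c c' different (fromFull g) g-fixes))

    Card-Fix : CardFix Γ ((d ∸ l) ! * t ^ (d ∸ l) * prodFin (λ j → f j ^ α j))
    Card-Fix = subst (CardFix Γ) size-eq (Card-fromFull (Fixes (mem Γ))
      (Card-decomposition (Fixes (mem Γ) ∘ to ∘ fromFull)
        (λ π F branches-fixed → λ { root _ → refl ;
           (child c w) r → cong₂ child (proj₁ (branches-fixed (c , tt)) (branch-root∈ Γ c w r)) (proj₂ (proj₂ (branches-fixed (c , tt))) w r) })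
        (λ π F fixes (c , _) →
           (λ p → child-injectiveˡ (fixes (child c root) p)) ,
           -- if π c lies in Γ it is fixed: π (π c) = π c, so π c = c
           (λ q → subst (T ∘ Inside) (cong proj₁ (Injection.injective (↔⇒↣ π) (firstLevel-≡ Full (child-injectiveˡ (fixes (child _ root) q))))) q) ,
           (λ v r → child-injectiveʳ (fixes (child c v) r)))
        (λ φ ψ φ≈ψ fixes v r → trans (sym (cong proj₁ (φ≈ψ (v , tt)))) (fixes v r))
        Card-fillings))
      where
      open ≡-Reasoning
      size-eq : product (λ n → count fixClass n ! * fixSize n ^ count fixClass n) ≡ (d ∸ l) ! * t ^ (d ∸ l) * prodFin (λ j → f j ^ α j)
      size-eq = cong₂ _*_ (cong (λ n → n ! * t ^ n) count-fixClass-zero) (begin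
        product (λ c → count fixClass (suc c) ! * fixSize (suc c) ^ count fixClass (suc c)) ≡⟨ product-cong fixFactor ⟩
        product (λ c → branchFixSize (classOf c))                                              ≡⟨ product-count classOf branchFixSize ⟩
        1 ^ count classOf zero * product (λ j → f j ^ count classOf (suc j))                  ≡⟨ cong₂ _*_ (^-zeroˡ (count classOf zero))
                                                                                                          (product-cong λ j → cong (f j ^_) (count-classOf-suc j)) ⟩
        1 * product (λ j → f j ^ α j)                                                          ≡⟨ +-identityʳ _ ⟩
        product (λ j → f j ^ α j)                                                              ≡⟨ prodFin≡product (λ j → f j ^ α j) ⟨
        prodFin (λ j → f j ^ α j)                                                              ∎)

mainTheorem9 : (d k : ℕ) → 1 ≤ d → (Γ : Subtree d (suc k)) → (l : ℕ) → RootDeg Γ l → l ≤ d →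
    (i : ℕ) (Γs : Fin i → Subtree d k) (α : Fin i → ℕ) → IsTypeOf Γ Γs α →
    ((a : Fin i → ℕ) → (∀ j → CardAut (SubG (Γs j)) (a j)) →
        CardAut (SubG Γ) (prodFin (λ j → (α j) ! * a j ^ α j)))
    × ((t : ℕ) (s : Fin i → ℕ) → CardAut (TreeG d k) t → (∀ j → CardSt (Γs j) (s j)) →
        CardSt Γ ((d ∸ l) ! * t ^ (d ∸ l) * prodFin (λ j → (α j) ! * s j ^ α j)))
    × ((t : ℕ) (f : Fin i → ℕ) → CardAut (TreeG d k) t → (∀ j → CardFix (Γs j) (f j)) →
        CardFix Γ ((d ∸ l) ! * t ^ (d ∸ l) * prodFin (λ j → f j ^ α j)))
mainTheorem9 d k _ Γ l rootDeg _ i Γs α type =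
  (λ a Aut-Γs → Automorphisms.Card-Aut a Aut-Γs) ,
  (λ t s Aut-T St-Γs → Stabilizer.Card-St t s Aut-T St-Γs) ,
  (λ t f Aut-T Fix-Γs → Fixator.Card-Fix t f Aut-T Fix-Γs)
  where open Counts d k Γ l rootDeg i Γs α type
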